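{- Let $i\in[n]$ and let $\sigma\in S_n$ satisfy $\mathrm{supp}(\sigma)\subseteq[i]$. Then (1) $$\sum_{r\in S_n:\ \mathrm{Des}_S(r^{ -1})\subseteq\{i\}}q^{\ell_S(\sigma r)}t^{\bar\epsilon_S(\sigma r)}=q^{\ell_S(\sigma)}t^{\bar\epsilon_S(\sigma)}\left({n-1\brack i-1}_q+t_iq^i{n-1\brack i}_q\right),$$ (2) $$\sum_{r\in S_n:\ \mathrm{Des}_S(r^{ -1})\subseteq\{i\}}q^{\mathrm{rmaj}_{S_n}(\sigma r)}t^{\bar\epsilon_S(\sigma r)}=q^{\mathrm{rmaj}_{S_i}(\sigma)}t^{\bar\epsilon_S(\sigma)}\left({n-1\brack i-1}_q+t_iq^i{n-1\brack i}_q\right).$$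
   Context: $\mathrm{supp}(\sigma)=\{k:\sigma(k)\ne k\}$; a permutation with support in $[i]$ is also regarded as an element of $S_i$. Permutations are in one-line notation and multiplied as functions, $(\sigma\tau)(k)=\sigma(\tau(k))$; $s_j=(j,j+1)$. $\mathrm{Des}_S(\pi)=\{j:\pi(j)>\pi(j+1)\}$; $\mathrm{rmaj}_{S_m}(\pi)=\sum_{j\in\mathrm{Des}_S(\pi)}(m-j)$ for $\pi\in S_m$; $\ell_S$ = number of inversions. $R^S_j=\{1,s_j,s_js_{j-1},\dots,s_j\cdots s_1\}$; every $w\in S_n$ factors uniquely as $w_1\cdots w_{n-1}$ with $w_j\in R^S_j$; $\epsilon_{S,j}(w)=1$ if $w_j=s_j\cdots s_1$ and $0$ otherwise, and $t^{\bar\epsilon_S(w)}=\prod_{j=1}^{n-1}t_j^{\epsilon_{S,j}(w)}$, with $t_1,t_2,\dots$ indeterminates. ${n\brack i}_q=\frac{[n]!_q}{[i]!_q[n-i]!_q}$ (zero if $i>n$), $[m]!_q=\prod_{k=1}^m(1+q+\dots+q^{k-1})$. -}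

module Defs where

open import Level using (Level)
open import Data.Bool using (Bool; true; false; if_then_else_; _∧_; not)
open import Data.Nat using (ℕ; zero; suc; _∸_; _≡ᵇ_; _<ᵇ_) renaming (_+_ to _+ℕ_)
open import Data.List using (List; []; _∷_; map; foldr; filterᵇ; concatMap; upTo; length; _++_; take)
open import Data.Bool.ListAction using (all; any)
open import Data.List.Properties using (≡-dec)
open import Data.Nat.Properties using (_≟_)
open import Relation.Nullary.Decidable using (⌊_⌋)
open import Algebra.Bundles using (CommutativeRing)

-- Conventions.  A permutation of [m] = {1,…,m} is represented by its
-- one-line notation: the list [π(1), …, π(m)] of natural numbers.

range : ℕ → List ℕ
range m = map suc (upTo m)

-- π(k) for a one-line list π; positions outside the list are fixed
-- (so a permutation of [i] acts as a permutation of [n] fixing i+1..n).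
app : List ℕ → ℕ → ℕ
app []       k             = k
app (x ∷ xs) zero          = zero
app (x ∷ xs) (suc zero)    = x
app (x ∷ xs) (suc (suc k)) = app xs (suc k)

_∙ₚ_ : List ℕ → List ℕ → List ℕ
σ ∙ₚ τ = map (app σ) τ

pos : ℕ → List ℕ → ℕ
pos k []       = 0
pos k (x ∷ xs) = if x ≡ᵇ k then 1 else suc (pos k xs)

inverse : List ℕ → List ℕ
inverse π = map (λ k → pos k π) (range (length π))

words : ℕ → ℕ → List (List ℕ)
words zero    n = [] ∷ []
words (suc m) n = concatMap (λ x → map (x ∷_) (words m n)) (range n)

distinct : List ℕ → Bool
distinct []       = true
distinct (x ∷ xs) = not (any (_≡ᵇ x) xs) ∧ distinct xs

Sym : ℕ → List (List ℕ)
Sym n = filterᵇ distinct (words n n)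

desFrom : ℕ → List ℕ → List ℕ
desFrom j []           = []
desFrom j (x ∷ [])     = []
desFrom j (x ∷ y ∷ xs) = if y <ᵇ x then j ∷ desFrom (suc j) (y ∷ xs)
                                   else desFrom (suc j) (y ∷ xs)

Des : List ℕ → List ℕ
Des π = desFrom 1 π

desSubsetSingleton : ℕ → List ℕ → Bool
desSubsetSingleton i π = all (_≡ᵇ i) (Des π)

rmaj : List ℕ → ℕ
rmaj π = foldr (λ j acc → (length π ∸ j) +ℕ acc) 0 (Des π)

-- ℓ_S(π) = number of inversions
countLess : ℕ → List ℕ → ℕ
countLess x []       = 0
countLess x (y ∷ ys) = if y <ᵇ x then suc (countLess x ys) else countLess x ys

invs : List ℕ → ℕ
invs []       = 0
invs (x ∷ xs) = countLess x xs +ℕ invs xs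

s : ℕ → ℕ → ℕ
s j k = if k ≡ᵇ j then suc j else (if k ≡ᵇ suc j then j else k)

-- the element s_j s_{j-1} ⋯ s_{j-k+1} of R^S_j (k factors, 0 ≤ k ≤ j);
-- k = 0 gives 1 and k = j gives s_j ⋯ s_1
cyc : ℕ → ℕ → ℕ → ℕ
cyc j zero    x = x
cyc j (suc k) x = s j (cyc (j ∸ 1) k x)

-- all tuples (k_1, …, k_m) with 0 ≤ k_j ≤ j
tuples : ℕ → List (List ℕ)
tuples zero    = [] ∷ []
tuples (suc m) = concatMap (λ ks → map (λ k → ks ++ (k ∷ [])) (upTo (suc (suc m)))) (tuples m)

prodFrom : ℕ → List ℕ → ℕ → ℕ
prodFrom j []       x = x
prodFrom j (k ∷ ks) x = cyc j k (prodFrom (suc j) ks x)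

tupleWord : ℕ → List ℕ → List ℕ
tupleWord n ks = map (prodFrom 1 ks) (range n)

findTuple : ℕ → List ℕ → List (List ℕ) → List ℕ
findTuple n w []         = []
findTuple n w (ks ∷ kss) = if ⌊ ≡-dec _≟_ (tupleWord n ks) w ⌋ then ks else findTuple n w kss

factorTuple : List ℕ → List ℕ
factorTuple w = findTuple (length w) w (tuples (length w ∸ 1))

-- ε_{S,j}(w) = 1 iff w_j = s_j ⋯ s_1, i.e. k_j = j
nth : ℕ → List ℕ → ℕ
nth j []             = 0
nth zero (x ∷ xs)    = x
nth (suc j) (x ∷ xs) = nth j xs

ε : ℕ → List ℕ → Bool
ε j w = nth (j ∸ 1) (factorTuple w) ≡ᵇ j

module RingDefs {c ℓ : Level} (R : CommutativeRing c ℓ) where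
  open CommutativeRing R

  pow : Carrier → ℕ → Carrier
  pow x zero    = 1#
  pow x (suc k) = x * pow x k

  sumR : List Carrier → Carrier
  sumR = foldr _+_ 0#

  tbar : (ℕ → Carrier) → List ℕ → Carrier
  tbar t w = foldr (λ j acc → (if ε j w then t j else 1#) * acc) 1# (range (length w ∸ 1))

  qbin : Carrier → ℕ → ℕ → Carrier
  qbin q n       zero    = 1#
  qbin q zero    (suc k) = 0#
  qbin q (suc n) (suc k) = qbin q n k + pow q (suc k) * qbin q n (suc k)

-- Permutations r with Des(r⁻¹) ⊆ {i} are exactly the shuffles of 1⋯i with i+1⋯n, so for σ supported in [i]
-- the words σr are the shuffles w of u = σ(1)⋯σ(i) with the increasing word i+1⋯n.
-- Splitting by the first letter, the sums of q^ℓ(w) and of q^rmaj(w) obey the q-Pascal recursion (its dual form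
-- when the first two letters form a descent): shuffles starting in u contribute q^stat(u)·[n-1, i-1]_q and those
-- starting with i+1 contribute q^stat(u)·q^i·[n-1, i]_q.
-- Inserting i+1, …, n one at a time extends the factorisation of u by one factor each, and that factor is the
-- full cycle s_j ⋯ s_1 only for j = i with i+1 put in front; hence t^ε̄(w) = t^ε̄(σ)·(t_i if w starts with i+1).

module Submission where

open import Defs
open import Data.Nat using (ℕ; suc; _≤_; _<_; _∸_)
open import Data.List using (List; _∷_; _++_; map; filterᵇ; take; length)
import Data.List.Relation.Unary.All as All
open All using (All)
open import Data.Product using (_×_; _,_)
open import Relation.Binary.PropositionalEquality using (_≢_; refl; sym; cong)
open import Data.List.Relation.Binary.Permutation.Propositional using (_↭_)
open import Algebra.Bundles using (CommutativeRing)

-- Kept in an anonymous module so that ℕ's _+_ is not in scope in the statement, whose _+_ is the ring's.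
module _ where

  open import Function using (_∘_)
  open import Data.Bool using (Bool; true; false; if_then_else_; T)
  open import Data.Bool.ListAction using (all; any)
  open import Data.Empty using (⊥; ⊥-elim)
  open import Data.Unit using (tt)
  open import Data.Nat using (zero; _+_; z≤n; s≤s; _≡ᵇ_; _<ᵇ_)
  open import Data.Nat.Properties
  open import Data.Product using (Σ; proj₁; proj₂)
  open import Data.Sum using (inj₁; inj₂)
  open import Data.List using ([]; [_]; foldr; concatMap; upTo; applyUpTo; drop; replicate)
  open import Data.List.Properties using (map-++; ++-assoc; length-++; length-map; length-drop; take++drop≡id; ++-identityʳ; ∷-injective; ∷-injectiveˡ; ∷-injectiveʳ; map-cong; map-∘; ≡-dec)
  open import Data.List.Relation.Unary.All using ([]; _∷_)
  import Data.List.Relation.Unary.All.Properties as All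
  open import Data.List.Relation.Unary.Linked using (Linked; []; [-]; _∷_)
  open import Data.List.Relation.Unary.AllPairs using ([]; _∷_)
  open import Data.List.Relation.Unary.Unique.Propositional as Unique using (Unique)
  import Data.List.Relation.Unary.Unique.Propositional.Properties as Unique
  open import Data.List.Membership.Propositional using (_∈_; _∉_; find; lose)
  open import Data.List.Membership.Propositional.Properties using (∈-map⁺; ∈-map⁻; ∈-++⁺ˡ; ∈-++⁺ʳ; ∈-++⁻; ∈-∃++; ∈-filter⁺; ∈-filter⁻; ∈-concatMap⁺; ∈-concatMap⁻; ∈-applyUpTo⁺; ∈-applyUpTo⁻)
  open import Data.List.Relation.Unary.Any using (here; there)
  open import Data.List.Relation.Binary.Permutation.Propositional using (↭-sym; ↭-trans; ↭-refl; prep; swap; ↭⇒↭ₛ; ↭⇒↭ₛ′)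
  open import Data.List.Relation.Binary.Permutation.Propositional.Properties using (∈-resp-↭; ↭-length; shift; drop-mid; ↭-singleton-inv)
  import Data.List.Relation.Binary.Permutation.Propositional.Properties as ↭
  import Data.List.Relation.Binary.Permutation.Setoid.Properties as ↭ₛ
  open import Relation.Nullary using (¬_; yes; no)
  open import Relation.Nullary.Decidable.Core using (T?)
  open import Relation.Binary.PropositionalEquality using (_≡_; trans; cong₂; subst; subst₂; module ≡-Reasoning)
  import Relation.Binary.PropositionalEquality as ≡

  Unique-resp-↭ : ∀ {A : Set} {xs ys : List A} → xs ↭ ys → Unique xs → Unique ys
  Unique-resp-↭ {A} p = ↭ₛ.Unique-resp-↭ (≡.setoid A) (↭⇒↭ₛ p)

  ∉-head : ∀ {A : Set} {x : A} {xs} → Unique (x ∷ xs) → x ∉ xs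
  ∉-head (x∉ ∷ _) x∈ = All.lookup x∉ x∈ refl

  Unique-++ˡ : ∀ {A : Set} (xs : List A) {ys} → Unique (xs ++ ys) → Unique xs
  Unique-++ˡ [] _ = []
  Unique-++ˡ (x ∷ xs) {ys} (x∉ ∷ u) = All.tabulate (λ z∈ → All.lookup x∉ (∈-++⁺ˡ z∈)) ∷ Unique-++ˡ xs u

  Unique-++ʳ : ∀ {A : Set} (xs : List A) {ys} → Unique (xs ++ ys) → Unique ys
  Unique-++ʳ [] u = u
  Unique-++ʳ (x ∷ xs) (_ ∷ u) = Unique-++ʳ xs u

  Unique-++⇒disjoint : ∀ {A : Set} (xs : List A) {ys} {x} → Unique (xs ++ ys) → x ∈ xs → x ∉ ys
  Unique-++⇒disjoint (x ∷ xs) (x∉ ∷ u) (here refl) x∈ = All.lookup x∉ (∈-++⁺ʳ xs x∈) refl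
  Unique-++⇒disjoint (x ∷ xs) (_ ∷ u) (there p) = Unique-++⇒disjoint xs u p

  ∈-++-∷⁻ : ∀ {A : Set} (B C : List A) {x z : A} → z ∈ B ++ x ∷ C → z ≢ x → z ∈ B ++ C
  ∈-++-∷⁻ [] C (here refl) z≢x = ⊥-elim (z≢x refl)
  ∈-++-∷⁻ [] C (there z∈) _ = z∈
  ∈-++-∷⁻ (b ∷ B) C (here refl) _ = here refl
  ∈-++-∷⁻ (b ∷ B) C (there z∈) z≢x = there (∈-++-∷⁻ B C z∈ z≢x)

  ∈-++-∷⁺ : ∀ {A : Set} (B C : List A) {x z : A} → z ∈ B ++ C → z ∈ B ++ x ∷ C
  ∈-++-∷⁺ [] C z∈ = there z∈
  ∈-++-∷⁺ (b ∷ B) C (here refl) = here refl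
  ∈-++-∷⁺ (b ∷ B) C (there z∈) = there (∈-++-∷⁺ B C z∈)

  All-∈-++-∷⁻ : ∀ {A : Set} (B C : List A) {x} {zs} → All (_∈ B ++ x ∷ C) zs → All (x ≢_) zs → All (_∈ B ++ C) zs
  All-∈-++-∷⁻ B C [] [] = []
  All-∈-++-∷⁻ B C (z∈ ∷ ps) (x≢z ∷ ns) = ∈-++-∷⁻ B C z∈ (x≢z ∘ sym) ∷ All-∈-++-∷⁻ B C ps ns

  unique-sameElements⇒↭ : ∀ {A : Set} (xs ys : List A) → Unique xs → Unique ys →
    (∀ {z} → z ∈ xs → z ∈ ys) → (∀ {z} → z ∈ ys → z ∈ xs) → xs ↭ ys
  unique-sameElements⇒↭ [] [] _ _ _ _ = ↭-refl
  unique-sameElements⇒↭ [] (y ∷ ys) _ _ _ ys⊆ with ys⊆ (here refl)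
  ... | ()
  unique-sameElements⇒↭ (x ∷ xs) ys uxs uys xs⊆ ys⊆ with ∈-∃++ (xs⊆ (here refl))
  ... | B , C , refl = ↭-trans (prep x rest) (↭-sym (shift x B C))
    where
    uys′ : Unique (x ∷ B ++ C)
    uys′ = Unique-resp-↭ (shift x B C) uys
    fromTail : ∀ {z} → z ∈ B ++ C → z ∈ x ∷ xs → z ∈ xs
    fromTail z∈ (here refl) = ⊥-elim (∉-head uys′ z∈)
    fromTail _ (there z∈) = z∈
    rest : xs ↭ B ++ C
    rest = unique-sameElements⇒↭ xs (B ++ C) (Unique.tail uxs) (Unique.tail uys′)
             (λ z∈ → ∈-++-∷⁻ B C (xs⊆ (there z∈)) (λ { refl → ∉-head uxs z∈ }))
             (λ z∈ → fromTail z∈ (ys⊆ (∈-++-∷⁺ B C z∈)))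

  ↭-cancelʳ : ∀ {A : Set} (xs ys zs : List A) → xs ++ zs ↭ ys ++ zs → xs ↭ ys
  ↭-cancelʳ xs ys [] p = subst₂ _↭_ (++-identityʳ xs) (++-identityʳ ys) p
  ↭-cancelʳ xs ys (z ∷ zs) p = ↭-cancelʳ xs ys zs (drop-mid xs ys p)

  ∈-map-∷⁻ : ∀ {A : Set} {w} x (L : List (List A)) → w ∈ map (x ∷_) L → Σ (List A) λ w′ → w ≡ x ∷ w′ × w′ ∈ L
  ∈-map-∷⁻ x L p with ∈-map⁻ (x ∷_) p
  ... | w′ , w′∈ , refl = w′ , refl , w′∈

  ∈-map-∷⁺ : ∀ {A : Set} {w} x (L : List (List A)) → w ∈ L → x ∷ w ∈ map (x ∷_) L
  ∈-map-∷⁺ x L = ∈-map⁺ (x ∷_)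

  map-∷-unique : ∀ {A : Set} x {L : List (List A)} → Unique L → Unique (map (x ∷_) L)
  map-∷-unique x = Unique.map⁺ ∷-injectiveʳ

  interval : ℕ → ℕ → List ℕ
  interval lo zero = []
  interval lo (suc m) = lo ∷ interval (suc lo) m

  map-suc-applyUpTo : ∀ (f : ℕ → ℕ) lo n → (∀ k → f k ≡ lo + k) → map suc (applyUpTo f n) ≡ interval (suc lo) n
  map-suc-applyUpTo f lo zero _ = refl
  map-suc-applyUpTo f lo (suc n) f≗ =
    cong₂ _∷_ (cong suc (trans (f≗ 0) (+-identityʳ lo)))
      (map-suc-applyUpTo (f ∘ suc) (suc lo) n (λ k → trans (f≗ (suc k)) (+-suc lo k)))

  range≡interval : ∀ n → range n ≡ interval 1 n
  range≡interval n = map-suc-applyUpTo (λ k → k) 0 n (λ _ → refl)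

  interval-++ : ∀ lo a b → interval lo (a + b) ≡ interval lo a ++ interval (lo + a) b
  interval-++ lo zero b = cong (λ z → interval z b) (sym (+-identityʳ lo))
  interval-++ lo (suc a) b =
    cong (lo ∷_) (trans (interval-++ (suc lo) a b) (cong (λ z → interval (suc lo) a ++ interval z b) (sym (+-suc lo a))))

  interval-∷ʳ : ∀ lo m → interval lo (suc m) ≡ interval lo m ++ [ lo + m ]
  interval-∷ʳ lo m = trans (cong (interval lo) (+-comm 1 m)) (interval-++ lo m 1)

  length-interval : ∀ lo m → length (interval lo m) ≡ m
  length-interval lo zero = refl
  length-interval lo (suc m) = cong suc (length-interval (suc lo) m)

  ∈-interval⁻ : ∀ {x} lo m → x ∈ interval lo m → lo ≤ x × x < lo + m
  ∈-interval⁻ lo (suc m) (here refl) = ≤-refl , subst (lo <_) (sym (+-suc lo m)) (s≤s (m≤m+n lo m))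
  ∈-interval⁻ {x} lo (suc m) (there x∈) with ∈-interval⁻ (suc lo) m x∈
  ... | lo<x , x< = <⇒≤ lo<x , subst (x <_) (sym (+-suc lo m)) x<

  ↭-interval⇒All< : ∀ {u} k → u ↭ interval 1 k → All (_< suc k) u
  ↭-interval⇒All< k u↭ = All.tabulate (λ y∈ → proj₂ (∈-interval⁻ 1 k (∈-resp-↭ u↭ y∈)))

  interval-unique : ∀ lo m → Unique (interval lo m)
  interval-unique lo zero = []
  interval-unique lo (suc m) = above (suc lo) m ≤-refl ∷ interval-unique (suc lo) m
    where
    above : ∀ l k → lo < l → All (lo ≢_) (interval l k)
    above l zero _ = []
    above l (suc k) lo<l = (λ e → <-irrefl e lo<l) ∷ above (suc l) k (m<n⇒m<1+n lo<l)

  map-interval : ∀ (f : ℕ → ℕ) lo lo′ n → (∀ d → d < n → f (lo + d) ≡ lo′ + d) → map f (interval lo n) ≡ interval lo′ n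
  map-interval f lo lo′ zero _ = refl
  map-interval f lo lo′ (suc n) f≗ =
    cong₂ _∷_ (trans (cong f (sym (+-identityʳ lo))) (trans (f≗ 0 (s≤s z≤n)) (+-identityʳ lo′)))
      (map-interval f (suc lo) (suc lo′) n
        (λ d d<n → trans (cong f (sym (+-suc lo d))) (trans (f≗ (suc d) (s≤s d<n)) (+-suc lo′ d))))

  -- positions are 0-based
  insertAt : ℕ → ℕ → List ℕ → List ℕ
  insertAt zero y l = y ∷ l
  insertAt (suc p) y [] = y ∷ []
  insertAt (suc p) y (x ∷ l) = x ∷ insertAt p y l

  ++-∷≡insertAt : ∀ (A B : List ℕ) y → A ++ y ∷ B ≡ insertAt (length A) y (A ++ B)
  ++-∷≡insertAt [] B y = refl
  ++-∷≡insertAt (a ∷ A) B y = cong (a ∷_) (++-∷≡insertAt A B y)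

  map-insertAt : ∀ (f : ℕ → ℕ) p y l → p ≤ length l → map f (insertAt p y l) ≡ insertAt p (f y) (map f l)
  map-insertAt f zero y l _ = refl
  map-insertAt f (suc p) y (x ∷ l) (s≤s p≤) = cong (f x ∷_) (map-insertAt f p y l p≤)

  insertAt-injective : ∀ p p′ y l l′ → p ≤ length l → p′ ≤ length l′ → y ∉ l → y ∉ l′ →
    insertAt p y l ≡ insertAt p′ y l′ → p ≡ p′ × l ≡ l′
  insertAt-injective zero zero y l l′ _ _ _ _ e = refl , ∷-injectiveʳ e
  insertAt-injective zero (suc p′) y l (x′ ∷ l′) _ _ _ y∉l′ e with ∷-injective e
  ... | refl , _ = ⊥-elim (y∉l′ (here refl))
  insertAt-injective (suc p) zero y (x ∷ l) l′ _ _ y∉l _ e with ∷-injective e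
  ... | refl , _ = ⊥-elim (y∉l (here refl))
  insertAt-injective (suc p) (suc p′) y (x ∷ l) (x′ ∷ l′) (s≤s p≤) (s≤s p′≤) y∉l y∉l′ e with ∷-injective e
  ... | refl , e′ with insertAt-injective p p′ y l l′ p≤ p′≤ (y∉l ∘ there) (y∉l′ ∘ there) e′
  ... | refl , refl = refl , refl

  -- Shuffles

  shuffles : List ℕ → List ℕ → List (List ℕ)
  shuffles [] [] = [] ∷ []
  shuffles [] (y ∷ ys) = map (y ∷_) (shuffles [] ys)
  shuffles (x ∷ xs) [] = map (x ∷_) (shuffles xs [])
  shuffles (x ∷ xs) (y ∷ ys) = map (x ∷_) (shuffles xs (y ∷ ys)) ++ map (y ∷_) (shuffles (x ∷ xs) ys)

  shuffles-[]ˡ : ∀ v → shuffles [] v ≡ v ∷ []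
  shuffles-[]ˡ [] = refl
  shuffles-[]ˡ (y ∷ v) = cong (map (y ∷_)) (shuffles-[]ˡ v)

  shuffles-[]ʳ : ∀ u → shuffles u [] ≡ u ∷ []
  shuffles-[]ʳ [] = refl
  shuffles-[]ʳ (x ∷ xs) = cong (map (x ∷_)) (shuffles-[]ʳ xs)

  ∈-shuffles-[]ʳ : ∀ u {w} → w ∈ shuffles u [] → w ≡ u
  ∈-shuffles-[]ʳ u w∈ with subst (_ ∈_) (shuffles-[]ʳ u) w∈
  ... | here w≡u = w≡u

  map-map-∷ : ∀ (f : ℕ → ℕ) x (L : List (List ℕ)) → map (map f) (map (x ∷_) L) ≡ map (f x ∷_) (map (map f) L)
  map-map-∷ f x [] = refl
  map-map-∷ f x (w ∷ L) = cong (_ ∷_) (map-map-∷ f x L)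

  map-shuffles : ∀ (f : ℕ → ℕ) u v → map (map f) (shuffles u v) ≡ shuffles (map f u) (map f v)
  map-shuffles f [] [] = refl
  map-shuffles f [] (y ∷ ys) = trans (map-map-∷ f y _) (cong (map (f y ∷_)) (map-shuffles f [] ys))
  map-shuffles f (x ∷ xs) [] = trans (map-map-∷ f x _) (cong (map (f x ∷_)) (map-shuffles f xs []))
  map-shuffles f (x ∷ xs) (y ∷ ys) = begin
      map (map f) (map (x ∷_) (shuffles xs (y ∷ ys)) ++ map (y ∷_) (shuffles (x ∷ xs) ys))
    ≡⟨ map-++ (map f) (map (x ∷_) (shuffles xs (y ∷ ys))) _ ⟩
      map (map f) (map (x ∷_) (shuffles xs (y ∷ ys))) ++ map (map f) (map (y ∷_) (shuffles (x ∷ xs) ys))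
    ≡⟨ cong₂ _++_ (trans (map-map-∷ f x _) (cong (map (f x ∷_)) (map-shuffles f xs (y ∷ ys))))
                  (trans (map-map-∷ f y _) (cong (map (f y ∷_)) (map-shuffles f (x ∷ xs) ys))) ⟩
      shuffles (map f (x ∷ xs)) (map f (y ∷ ys)) ∎
    where open ≡-Reasoning

  ∈-shuffles⇒↭ : ∀ u v {w} → w ∈ shuffles u v → w ↭ u ++ v
  ∈-shuffles⇒↭ [] [] (here refl) = ↭-refl
  ∈-shuffles⇒↭ [] (y ∷ ys) w∈ with ∈-map-∷⁻ y _ w∈
  ... | _ , refl , w′∈ = prep y (∈-shuffles⇒↭ [] ys w′∈)
  ∈-shuffles⇒↭ (x ∷ xs) [] w∈ with ∈-map-∷⁻ x _ w∈
  ... | _ , refl , w′∈ = prep x (∈-shuffles⇒↭ xs [] w′∈)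
  ∈-shuffles⇒↭ (x ∷ xs) (y ∷ ys) w∈ with ∈-++⁻ (map (x ∷_) (shuffles xs (y ∷ ys))) w∈
  ... | inj₁ w∈ˡ with ∈-map-∷⁻ x _ w∈ˡ
  ... | _ , refl , w′∈ = prep x (∈-shuffles⇒↭ xs (y ∷ ys) w′∈)
  ∈-shuffles⇒↭ (x ∷ xs) (y ∷ ys) w∈ | inj₂ w∈ʳ with ∈-map-∷⁻ y _ w∈ʳ
  ... | _ , refl , w′∈ = ↭-trans (prep y (∈-shuffles⇒↭ (x ∷ xs) ys w′∈)) (↭-sym (shift y (x ∷ xs) ys))

  ∈-shuffles⇒length : ∀ u lo m {w} → w ∈ shuffles u (interval lo m) → length w ≡ length u + m
  ∈-shuffles⇒length u lo m w∈ =
    trans (↭-length (∈-shuffles⇒↭ u (interval lo m) w∈)) (trans (length-++ u) (cong (length u +_) (length-interval lo m)))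

  ∈-shuffles-∷ˡ⁺ : ∀ x a b {r} → r ∈ shuffles a b → x ∷ r ∈ shuffles (x ∷ a) b
  ∈-shuffles-∷ˡ⁺ x a [] r∈ = ∈-map-∷⁺ x _ r∈
  ∈-shuffles-∷ˡ⁺ x a (_ ∷ _) r∈ = ∈-++⁺ˡ (∈-map-∷⁺ x _ r∈)

  ∈-shuffles-∷ʳ⁺ : ∀ a x b {r} → r ∈ shuffles a b → x ∷ r ∈ shuffles a (x ∷ b)
  ∈-shuffles-∷ʳ⁺ [] x b r∈ = ∈-map-∷⁺ x _ r∈
  ∈-shuffles-∷ʳ⁺ (z ∷ zs) x b r∈ = ∈-++⁺ʳ (map (z ∷_) (shuffles zs (x ∷ b))) (∈-map-∷⁺ x _ r∈)

  ++∈shuffles : ∀ u v → u ++ v ∈ shuffles u v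
  ++∈shuffles [] v = subst (v ∈_) (sym (shuffles-[]ˡ v)) (here refl)
  ++∈shuffles (x ∷ u) v = ∈-shuffles-∷ˡ⁺ x u v (++∈shuffles u v)

  shuffles-unique : ∀ u v → Unique (u ++ v) → Unique (shuffles u v)
  shuffles-unique [] [] _ = [] ∷ []
  shuffles-unique [] (y ∷ ys) (_ ∷ U) = map-∷-unique y (shuffles-unique [] ys U)
  shuffles-unique (x ∷ xs) [] U = map-∷-unique x (shuffles-unique xs [] (Unique.tail U))
  shuffles-unique (x ∷ xs) (y ∷ ys) U =
    Unique.++⁺ (map-∷-unique x (shuffles-unique xs (y ∷ ys) (Unique.tail U)))
               (map-∷-unique y (shuffles-unique (x ∷ xs) ys (Unique.tail (Unique-resp-↭ (shift y (x ∷ xs) ys) U))))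
               disjoint
    where
    disjoint : ∀ {w} → ¬ (w ∈ map (x ∷_) (shuffles xs (y ∷ ys)) × w ∈ map (y ∷_) (shuffles (x ∷ xs) ys))
    disjoint (w∈ˡ , w∈ʳ) with ∈-map-∷⁻ x _ w∈ˡ | ∈-map-∷⁻ y _ w∈ʳ
    ... | _ , refl , _ | _ , e , _ = Unique-++⇒disjoint (x ∷ xs) U (here refl) (here (∷-injectiveˡ e))

  startsWith : ℕ → List ℕ → Bool
  startsWith lo [] = false
  startsWith lo (x ∷ _) = x ≡ᵇ lo

  ∈-shuffles-∷ʳ⁻ : ∀ u v y {w} → w ∈ shuffles u (v ++ [ y ]) →
    Σ (List ℕ) λ w⁻ → Σ ℕ λ p → w⁻ ∈ shuffles u v × w ≡ insertAt p y w⁻ × p ≤ length w⁻ × (p ≡ 0 → v ≡ [])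
  ∈-shuffles-∷ʳ⁻ [] [] y (here refl) = [] , 0 , here refl , refl , z≤n , (λ _ → refl)
  ∈-shuffles-∷ʳ⁻ [] (z ∷ v) y w∈ with ∈-map-∷⁻ z _ w∈
  ... | _ , refl , w′∈ with ∈-shuffles-∷ʳ⁻ [] v y w′∈
  ... | w⁻ , p , w⁻∈ , refl , p≤ , _ = z ∷ w⁻ , suc p , ∈-shuffles-∷ʳ⁺ [] z v w⁻∈ , refl , s≤s p≤ , (λ ())
  ∈-shuffles-∷ʳ⁻ (x ∷ xs) [] y w∈ with ∈-++⁻ (map (x ∷_) (shuffles xs (y ∷ []))) w∈
  ... | inj₁ w∈ˡ with ∈-map-∷⁻ x _ w∈ˡ
  ... | _ , refl , w′∈ with ∈-shuffles-∷ʳ⁻ xs [] y w′∈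
  ... | w⁻ , p , w⁻∈ , refl , p≤ , _ = x ∷ w⁻ , suc p , ∈-shuffles-∷ˡ⁺ x xs [] w⁻∈ , refl , s≤s p≤ , (λ ())
  ∈-shuffles-∷ʳ⁻ (x ∷ xs) [] y w∈ | inj₂ w∈ʳ with ∈-map-∷⁻ y _ w∈ʳ
  ... | w′ , refl , w′∈ = w′ , 0 , w′∈ , refl , z≤n , (λ _ → refl)
  ∈-shuffles-∷ʳ⁻ (x ∷ xs) (z ∷ v) y w∈ with ∈-++⁻ (map (x ∷_) (shuffles xs (z ∷ v ++ [ y ]))) w∈
  ... | inj₁ w∈ˡ with ∈-map-∷⁻ x _ w∈ˡ
  ... | _ , refl , w′∈ with ∈-shuffles-∷ʳ⁻ xs (z ∷ v) y w′∈
  ... | w⁻ , p , w⁻∈ , refl , p≤ , _ = x ∷ w⁻ , suc p , ∈-shuffles-∷ˡ⁺ x xs (z ∷ v) w⁻∈ , refl , s≤s p≤ , (λ ())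
  ∈-shuffles-∷ʳ⁻ (x ∷ xs) (z ∷ v) y w∈ | inj₂ w∈ʳ with ∈-map-∷⁻ z _ w∈ʳ
  ... | _ , refl , w′∈ with ∈-shuffles-∷ʳ⁻ (x ∷ xs) v y w′∈
  ... | w⁻ , p , w⁻∈ , refl , p≤ , _ = z ∷ w⁻ , suc p , ∈-shuffles-∷ʳ⁺ (x ∷ xs) z v w⁻∈ , refl , s≤s p≤ , (λ ())

  true≢false : true ≢ false
  true≢false ()

  T⇒≡true : ∀ {b} → T b → b ≡ true
  T⇒≡true {true} _ = refl

  ¬T⇒≡false : ∀ {b} → ¬ T b → b ≡ false
  ¬T⇒≡false {false} _ = refl
  ¬T⇒≡false {true} ¬t = ⊥-elim (¬t tt)

  ≡ᵇ-refl : ∀ m → (m ≡ᵇ m) ≡ true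
  ≡ᵇ-refl m = T⇒≡true (≡⇒≡ᵇ m m refl)

  ≢⇒≡ᵇ≡false : ∀ {m n} → m ≢ n → (m ≡ᵇ n) ≡ false
  ≢⇒≡ᵇ≡false {m} {n} m≢n = ¬T⇒≡false (m≢n ∘ ≡ᵇ⇒≡ m n)

  <⇒<ᵇ≡true : ∀ {m n} → m < n → (m <ᵇ n) ≡ true
  <⇒<ᵇ≡true m<n = T⇒≡true (<⇒<ᵇ m<n)

  ≥⇒<ᵇ≡false : ∀ {m n} → n ≤ m → (m <ᵇ n) ≡ false
  ≥⇒<ᵇ≡false {m} {n} n≤m = ¬T⇒≡false (λ t → <⇒≱ (<ᵇ⇒< m n t) n≤m)

  <ᵇ≡false⇒≥ : ∀ {m n} → (m <ᵇ n) ≡ false → n ≤ m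
  <ᵇ≡false⇒≥ {m} {n} e = ≮⇒≥ (λ m<n → true≢false (trans (sym (<⇒<ᵇ≡true m<n)) e))

  pos-head : ∀ x r → pos x (x ∷ r) ≡ 1
  pos-head x r rewrite ≡ᵇ-refl x = refl

  pos-tail : ∀ {y x} r → y ≢ x → pos y (x ∷ r) ≡ suc (pos y r)
  pos-tail r y≢x rewrite ≢⇒≡ᵇ≡false (y≢x ∘ sym) = refl

  pos-∷-positive : ∀ y x r → 1 ≤ pos y (x ∷ r)
  pos-∷-positive y x r with x ≡ᵇ y
  ... | true = s≤s z≤n
  ... | false = s≤s z≤n

  pos-∷≤1⇒[] : ∀ y x r → y ≢ x → pos y (x ∷ r) ≤ 1 → r ≡ []
  pos-∷≤1⇒[] y x [] _ _ = refl
  pos-∷≤1⇒[] y x (z ∷ r) y≢x p≤1 =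
    ⊥-elim (<-irrefl refl (≤-trans (s≤s (pos-∷-positive y z r)) (subst (_≤ 1) (pos-tail (z ∷ r) y≢x) p≤1)))

  InOrder : List ℕ → List ℕ → Set
  InOrder a r = Linked _≤_ (map (λ k → pos k r) a)

  inOrder-∷⁺ : ∀ x r l → x ∉ l → InOrder l r → InOrder l (x ∷ r)
  inOrder-∷⁺ x r [] _ _ = []
  inOrder-∷⁺ x r (a ∷ []) _ _ = [-]
  inOrder-∷⁺ x r (a ∷ b ∷ l) x∉ (a≤b ∷ rest) =
    subst₂ _≤_ (sym (pos-tail r (x∉ ∘ here ∘ sym))) (sym (pos-tail r (x∉ ∘ there ∘ here ∘ sym))) (s≤s a≤b)
    ∷ inOrder-∷⁺ x r (b ∷ l) (x∉ ∘ there) rest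

  inOrder-∷⁻ : ∀ x r l → x ∉ l → InOrder l (x ∷ r) → InOrder l r
  inOrder-∷⁻ x r [] _ _ = []
  inOrder-∷⁻ x r (a ∷ []) _ _ = [-]
  inOrder-∷⁻ x r (a ∷ b ∷ l) x∉ (a≤b ∷ rest) =
    ≤-pred (subst₂ _≤_ (pos-tail r (x∉ ∘ here ∘ sym)) (pos-tail r (x∉ ∘ there ∘ here ∘ sym)) a≤b)
    ∷ inOrder-∷⁻ x r (b ∷ l) (x∉ ∘ there) rest

  inOrder-∷-∷ : ∀ x r l → x ∉ l → InOrder l r → InOrder (x ∷ l) (x ∷ r)
  inOrder-∷-∷ x r [] _ _ = [-]
  inOrder-∷-∷ x r (b ∷ l) x∉ ord =
    subst (_≤ pos b (x ∷ r)) (sym (pos-head x r)) (pos-∷-positive b x r) ∷ inOrder-∷⁺ x r (b ∷ l) x∉ ord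

  inOrder-tail : ∀ x l r → InOrder (x ∷ l) r → InOrder l r
  inOrder-tail x [] r _ = []
  inOrder-tail x (b ∷ l) r (_ ∷ rest) = rest

  inOrder-head-≤ : ∀ p l r {x} → InOrder (p ∷ l) r → x ∈ l → pos p r ≤ pos x r
  inOrder-head-≤ p (b ∷ l) r (p≤b ∷ rest) (here refl) = p≤b
  inOrder-head-≤ p (b ∷ l) r (p≤b ∷ rest) (there x∈) = ≤-trans p≤b (inOrder-head-≤ b l r rest x∈)

  shuffle⇒inOrder : ∀ a b {r} → r ∈ shuffles a b → Unique (a ++ b) → InOrder a r × InOrder b r
  shuffle⇒inOrder [] [] (here refl) _ = [] , []
  shuffle⇒inOrder [] (y ∷ ys) r∈ (y∉ ∷ U) with ∈-map-∷⁻ y _ r∈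
  ... | r′ , refl , r′∈ = [] , inOrder-∷-∷ y r′ ys (λ y∈ → All.lookup y∉ y∈ refl) (proj₂ (shuffle⇒inOrder [] ys r′∈ U))
  shuffle⇒inOrder (x ∷ xs) [] r∈ (x∉ ∷ U) with ∈-map-∷⁻ x _ r∈
  ... | r′ , refl , r′∈ =
    inOrder-∷-∷ x r′ xs (λ x∈ → All.lookup x∉ (∈-++⁺ˡ x∈) refl) (proj₁ (shuffle⇒inOrder xs [] r′∈ U)) , []
  shuffle⇒inOrder (x ∷ xs) (y ∷ ys) r∈ U with ∈-++⁻ (map (x ∷_) (shuffles xs (y ∷ ys))) r∈
  ... | inj₁ r∈ˡ with ∈-map-∷⁻ x _ r∈ˡ
  ... | r′ , refl , r′∈ with shuffle⇒inOrder xs (y ∷ ys) r′∈ (Unique.tail U)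
  ... | ordˡ , ordʳ =
    inOrder-∷-∷ x r′ xs (∉-head U ∘ ∈-++⁺ˡ) ordˡ , inOrder-∷⁺ x r′ (y ∷ ys) (Unique-++⇒disjoint (x ∷ xs) U (here refl)) ordʳ
  shuffle⇒inOrder (x ∷ xs) (y ∷ ys) r∈ U | inj₂ r∈ʳ with ∈-map-∷⁻ y _ r∈ʳ
  ... | r′ , refl , r′∈ with shuffle⇒inOrder (x ∷ xs) ys r′∈ (Unique.tail (Unique-resp-↭ (shift y (x ∷ xs) ys) U))
  ... | ordˡ , ordʳ =
    inOrder-∷⁺ y r′ (x ∷ xs) (λ y∈ → Unique-++⇒disjoint (x ∷ xs) U y∈ (here refl)) ordˡ ,
    inOrder-∷-∷ y r′ ys (∉-head (Unique-resp-↭ (shift y (x ∷ xs) ys) U) ∘ ∈-++⁺ʳ (x ∷ xs)) ordʳ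

  head-inOrder-∈-tail : ∀ p x (l r : List ℕ) k → p ≢ x → x ∈ l → InOrder (p ∷ l) (x ∷ r) →
    suc (length r) ≡ k + suc (length l) → ⊥
  head-inOrder-∈-tail p x l r k p≢x x∈ ord len with pos-∷≤1⇒[] p x r p≢x
    (subst (pos p (x ∷ r) ≤_) (pos-head x r) (inOrder-head-≤ p l (x ∷ r) ord x∈))
  head-inOrder-∈-tail p x (_ ∷ l) .[] k p≢x x∈ ord len | refl =
    <-irrefl refl (≤-trans (s≤s (s≤s z≤n)) (≤-trans (m≤n+m (suc (suc (length l))) k) (≤-reflexive (sym len))))

  inOrder⇒shuffle : ∀ a b r → Unique r → length r ≡ length a + length b → All (_∈ a ++ b) r →
    InOrder a r → InOrder b r → Unique (a ++ b) → r ∈ shuffles a b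
  inOrder⇒shuffle [] [] [] _ _ _ _ _ _ = here refl
  inOrder⇒shuffle a b (x ∷ r) _ _ (x∈ ∷ _) _ _ _ with ∈-++⁻ a x∈
  inOrder⇒shuffle (x ∷ a′) b (x ∷ r) (x∉ ∷ ur) len (_ ∷ r⊆) ordᵃ ordᵇ U | inj₁ (here refl) =
    ∈-shuffles-∷ˡ⁺ x a′ b (inOrder⇒shuffle a′ b r ur (suc-injective len) (All-∈-++-∷⁻ [] (a′ ++ b) r⊆ x∉)
      (inOrder-∷⁻ x r a′ (∉-head U ∘ ∈-++⁺ˡ) (inOrder-tail x a′ (x ∷ r) ordᵃ))
      (inOrder-∷⁻ x r b (Unique-++⇒disjoint (x ∷ a′) U (here refl)) ordᵇ) (Unique.tail U))
  inOrder⇒shuffle (a₀ ∷ a′) b (x ∷ r) _ len _ ordᵃ _ U | inj₁ (there x∈a′) =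
    ⊥-elim (head-inOrder-∈-tail a₀ x a′ r (length b) (λ { refl → ∉-head (Unique-++ˡ (a₀ ∷ a′) U) x∈a′ }) x∈a′ ordᵃ
      (trans len (trans (cong suc (+-comm (length a′) (length b))) (sym (+-suc (length b) (length a′))))))
  inOrder⇒shuffle a (x ∷ b′) (x ∷ r) (x∉ ∷ ur) len (_ ∷ r⊆) ordᵃ ordᵇ U | inj₂ (here refl) =
    ∈-shuffles-∷ʳ⁺ a x b′ (inOrder⇒shuffle a b′ r ur (suc-injective (trans len (+-suc (length a) (length b′))))
      (All-∈-++-∷⁻ a b′ r⊆ x∉)
      (inOrder-∷⁻ x r a (λ x∈ → Unique-++⇒disjoint a U x∈ (here refl)) ordᵃ)
      (inOrder-∷⁻ x r b′ (∉-head U′ ∘ ∈-++⁺ʳ a) (inOrder-tail x b′ (x ∷ r) ordᵇ)) (Unique.tail U′))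
    where
    U′ : Unique (x ∷ a ++ b′)
    U′ = Unique-resp-↭ (shift x a b′) U
  inOrder⇒shuffle a (b₀ ∷ b′) (x ∷ r) _ len _ _ ordᵇ U | inj₂ (there x∈b′) =
    ⊥-elim (head-inOrder-∈-tail b₀ x b′ r (length a) (λ { refl → ∉-head (Unique-++ʳ a U) x∈b′ }) x∈b′ ordᵇ len)

  ∈-words⁻ : ∀ m n {r} → r ∈ words m n → length r ≡ m × All (_∈ range n) r
  ∈-words⁻ zero n (here refl) = refl , []
  ∈-words⁻ (suc m) n r∈ with find (∈-concatMap⁻ (λ x → map (x ∷_) (words m n)) {xs = range n} r∈)
  ... | x , x∈ , r∈ˣ with ∈-map-∷⁻ x _ r∈ˣ
  ... | r′ , refl , r′∈ with ∈-words⁻ m n r′∈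
  ... | len , r′⊆ = cong suc len , x∈ ∷ r′⊆

  ∈-words⁺ : ∀ m n r → length r ≡ m → All (_∈ range n) r → r ∈ words m n
  ∈-words⁺ zero n [] _ _ = here refl
  ∈-words⁺ (suc m) n (x ∷ r) len (x∈ ∷ r⊆) =
    ∈-concatMap⁺ (λ x → map (x ∷_) (words m n)) (lose x∈ (∈-map-∷⁺ x _ (∈-words⁺ m n r (suc-injective len) r⊆)))

  concatMap-prefix-unique : ∀ (L : List ℕ) (W : List (List ℕ)) → Unique L → Unique W →
    Unique (concatMap (λ x → map (x ∷_) W) L)
  concatMap-prefix-unique [] W _ _ = []
  concatMap-prefix-unique (x ∷ L) W (x∉ ∷ uL) uW =
    Unique.++⁺ (map-∷-unique x uW) (concatMap-prefix-unique L W uL uW) disjoint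
    where
    disjoint : ∀ {w} → ¬ (w ∈ map (x ∷_) W × w ∈ concatMap (λ x → map (x ∷_) W) L)
    disjoint (w∈ˡ , w∈ʳ) with ∈-map-∷⁻ x _ w∈ˡ | find (∈-concatMap⁻ (λ x → map (x ∷_) W) {xs = L} w∈ʳ)
    ... | _ , refl , _ | y , y∈ , w∈ʸ with ∈-map-∷⁻ y _ w∈ʸ
    ... | _ , e , _ = All.lookup x∉ y∈ (∷-injectiveˡ e)

  words-unique : ∀ m n → Unique (words m n)
  words-unique zero n = [] ∷ []
  words-unique (suc m) n =
    concatMap-prefix-unique (range n) (words m n) (subst Unique (sym (range≡interval n)) (interval-unique 1 n)) (words-unique m n)

  any-≡ᵇ≡false⇒All-≢ : ∀ x xs → any (_≡ᵇ x) xs ≡ false → All (x ≢_) xs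
  any-≡ᵇ≡false⇒All-≢ x [] _ = []
  any-≡ᵇ≡false⇒All-≢ x (y ∷ xs) e with y ≡ᵇ x in y≡ᵇx
  ... | false = (λ { refl → true≢false (trans (sym (≡ᵇ-refl x)) y≡ᵇx) }) ∷ any-≡ᵇ≡false⇒All-≢ x xs e

  All-≢⇒any-≡ᵇ≡false : ∀ x xs → All (x ≢_) xs → any (_≡ᵇ x) xs ≡ false
  All-≢⇒any-≡ᵇ≡false x [] [] = refl
  All-≢⇒any-≡ᵇ≡false x (y ∷ xs) (x≢y ∷ ps) rewrite ≢⇒≡ᵇ≡false (x≢y ∘ sym) = All-≢⇒any-≡ᵇ≡false x xs ps

  distinct⇒Unique : ∀ r → distinct r ≡ true → Unique r
  distinct⇒Unique [] _ = []
  distinct⇒Unique (x ∷ r) e with any (_≡ᵇ x) r in notHere | distinct r in rest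
  distinct⇒Unique (x ∷ r) refl | false | true = any-≡ᵇ≡false⇒All-≢ x r notHere ∷ distinct⇒Unique r rest

  Unique⇒distinct : ∀ r → Unique r → distinct r ≡ true
  Unique⇒distinct [] _ = refl
  Unique⇒distinct (x ∷ r) (x∉ ∷ u) rewrite All-≢⇒any-≡ᵇ≡false x r x∉ = Unique⇒distinct r u

  ∈-Sym⁻ : ∀ n {r} → r ∈ Sym n → length r ≡ n × All (_∈ range n) r × Unique r
  ∈-Sym⁻ n r∈ with ∈-filter⁻ (λ r → T? (distinct r)) r∈
  ... | r∈w , dist with ∈-words⁻ n n r∈w
  ... | len , r⊆ = len , r⊆ , distinct⇒Unique _ (T⇒≡true dist)

  ∈-Sym⁺ : ∀ n r → length r ≡ n → All (_∈ range n) r → Unique r → r ∈ Sym n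
  ∈-Sym⁺ n r len r⊆ u =
    ∈-filter⁺ (λ r → T? (distinct r)) (∈-words⁺ n n r len r⊆) (subst T (sym (Unique⇒distinct r u)) tt)

  Sym-unique : ∀ n → Unique (Sym n)
  Sym-unique n = Unique.filter⁺ (λ r → T? (distinct r)) (words-unique n n)

  all-∷⁻ : ∀ (p : ℕ → Bool) x L → all p (x ∷ L) ≡ true → p x ≡ true × all p L ≡ true
  all-∷⁻ p x L h with p x | h
  ... | true | h′ = refl , h′

  all-if-∷⁻ : ∀ (p : ℕ → Bool) c d R → all p (if c then d ∷ R else R) ≡ true → all p R ≡ true
  all-if-∷⁻ p true d R h = proj₂ (all-∷⁻ p d R h)
  all-if-∷⁻ p false d R h = h

  all-if-∷⇒false : ∀ (p : ℕ → Bool) c d R → p d ≡ false → all p (if c then d ∷ R else R) ≡ true → c ≡ false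
  all-if-∷⇒false p true d R pd≡false h with trans (sym pd≡false) (proj₁ (all-∷⁻ p d R h))
  ... | ()
  all-if-∷⇒false p false d R _ _ = refl

  sorted⇒desFrom≡[] : ∀ d L → Linked _≤_ L → desFrom d L ≡ []
  sorted⇒desFrom≡[] d [] _ = refl
  sorted⇒desFrom≡[] d (x ∷ []) _ = refl
  sorted⇒desFrom≡[] d (x ∷ y ∷ L) (x≤y ∷ sorted) rewrite ≥⇒<ᵇ≡false {y} {x} x≤y = sorted⇒desFrom≡[] (suc d) (y ∷ L) sorted

  desFrom-below⇒sorted : ∀ e d L → e < d → all (_≡ᵇ e) (desFrom d L) ≡ true → Linked _≤_ L
  desFrom-below⇒sorted e d [] _ _ = []
  desFrom-below⇒sorted e d (x ∷ []) _ _ = [-]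
  desFrom-below⇒sorted e d (x ∷ y ∷ L) e<d h =
    <ᵇ≡false⇒≥ (all-if-∷⇒false (_≡ᵇ e) (y <ᵇ x) d _ (≢⇒≡ᵇ≡false (λ d≡e → <-irrefl (sym d≡e) e<d)) h)
    ∷ desFrom-below⇒sorted e (suc d) (y ∷ L) (m<n⇒m<1+n e<d) (all-if-∷⁻ (_≡ᵇ e) (y <ᵇ x) d _ h)

  desFromOnly-++⇒sorted : ∀ d a A B → all (_≡ᵇ (d + length A)) (desFrom d (a ∷ A ++ B)) ≡ true →
    Linked _≤_ (a ∷ A) × Linked _≤_ B
  desFromOnly-++⇒sorted d a [] [] _ = [-] , []
  desFromOnly-++⇒sorted d a [] (b ∷ B) h =
    [-] , desFrom-below⇒sorted (d + 0) (suc d) (b ∷ B) (s≤s (≤-reflexive (+-identityʳ d)))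
            (all-if-∷⁻ (_≡ᵇ (d + 0)) (b <ᵇ a) d _ h)
  desFromOnly-++⇒sorted d a (a₂ ∷ A) B h =
    <ᵇ≡false⇒≥ (all-if-∷⇒false (_≡ᵇ e) (a₂ <ᵇ a) d _ (≢⇒≡ᵇ≡false (<⇒≢ (m<m+n d (s≤s z≤n)))) h) ∷ proj₁ rest , proj₂ rest
    where
    e = d + suc (length A)
    rest : Linked _≤_ (a₂ ∷ A) × Linked _≤_ B
    rest = desFromOnly-++⇒sorted (suc d) a₂ A B
             (subst (λ e → all (_≡ᵇ e) (desFrom (suc d) (a₂ ∷ A ++ B)) ≡ true) (+-suc d (length A))
               (all-if-∷⁻ (_≡ᵇ e) (a₂ <ᵇ a) d _ h))

  sorted⇒desFromOnly-++ : ∀ d a A B → Linked _≤_ (a ∷ A) → Linked _≤_ B →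
    all (_≡ᵇ (d + length A)) (desFrom d (a ∷ A ++ B)) ≡ true
  sorted⇒desFromOnly-++ d a [] [] _ _ = refl
  sorted⇒desFromOnly-++ d a [] (b ∷ B) _ sortedʳ with b <ᵇ a
  ... | true rewrite +-identityʳ d | ≡ᵇ-refl d | sorted⇒desFrom≡[] (suc d) (b ∷ B) sortedʳ = refl
  ... | false rewrite sorted⇒desFrom≡[] (suc d) (b ∷ B) sortedʳ = refl
  sorted⇒desFromOnly-++ d a (a₂ ∷ A) B (a≤a₂ ∷ sortedˡ) sortedʳ rewrite ≥⇒<ᵇ≡false {a₂} {a} a≤a₂ =
    subst (λ e → all (_≡ᵇ e) (desFrom (suc d) (a₂ ∷ A ++ B)) ≡ true) (sym (+-suc d (length A)))
      (sorted⇒desFromOnly-++ (suc d) a₂ A B sortedˡ sortedʳ)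

  -- Permutations r with Des(r⁻¹) ⊆ {i}

  inverseGrassmannian : ℕ → ℕ → List (List ℕ)
  inverseGrassmannian i n = filterᵇ (λ r → desSubsetSingleton i (inverse r)) (Sym n)

  module _ (i₀ m : ℕ) where
    private
      n = suc i₀ + m
      low = interval 1 (suc i₀)
      high = interval (suc (suc i₀)) m
      positionsIn : List ℕ → List ℕ → List ℕ
      positionsIn r = map (λ k → pos k r)

    desSubsetSingleton-inverse≡ : ∀ r → length r ≡ n →
      desSubsetSingleton (suc i₀) (inverse r) ≡
      all (_≡ᵇ (1 + length (positionsIn r (interval 2 i₀)))) (desFrom 1 (pos 1 r ∷ positionsIn r (interval 2 i₀) ++ positionsIn r high))
    desSubsetSingleton-inverse≡ r len = begin
        all (_≡ᵇ suc i₀) (desFrom 1 (positionsIn r (range (length r))))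
      ≡⟨ cong (λ L → all (_≡ᵇ suc i₀) (desFrom 1 (positionsIn r L)))
           (trans (cong range len) (trans (range≡interval n) (interval-++ 1 (suc i₀) m))) ⟩
        all (_≡ᵇ suc i₀) (desFrom 1 (positionsIn r (low ++ high)))
      ≡⟨ cong (λ L → all (_≡ᵇ suc i₀) (desFrom 1 L)) (map-++ (λ k → pos k r) low high) ⟩
        all (_≡ᵇ suc i₀) (desFrom 1 (positionsIn r low ++ positionsIn r high))
      ≡⟨ cong (λ z → all (_≡ᵇ suc z) (desFrom 1 (positionsIn r low ++ positionsIn r high)))
           (sym (trans (length-map (λ k → pos k r) (interval 2 i₀)) (length-interval 2 i₀))) ⟩
        all (_≡ᵇ (1 + length (positionsIn r (interval 2 i₀)))) (desFrom 1 (positionsIn r low ++ positionsIn r high)) ∎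
      where open ≡-Reasoning

    private
      low++high : low ++ high ≡ interval 1 n
      low++high = sym (interval-++ 1 (suc i₀) m)

      low++high-unique : Unique (low ++ high)
      low++high-unique = subst Unique (sym low++high) (interval-unique 1 n)

      length-low++high : length low + length high ≡ n
      length-low++high = cong₂ _+_ (length-interval 1 (suc i₀)) (length-interval (suc (suc i₀)) m)

      range≡low++high : range n ≡ low ++ high
      range≡low++high = trans (range≡interval n) (sym low++high)

    ∈-inverseGrassmannian⇒shuffle : ∀ {r} → r ∈ inverseGrassmannian (suc i₀) n → r ∈ shuffles low high
    ∈-inverseGrassmannian⇒shuffle {r} r∈ with ∈-filter⁻ (λ r → T? (desSubsetSingleton (suc i₀) (inverse r))) r∈
    ... | r∈Sym , des with ∈-Sym⁻ n r∈Sym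
    ... | len , r⊆ , r-unique with desFromOnly-++⇒sorted 1 (pos 1 r) (positionsIn r (interval 2 i₀)) (positionsIn r high)
                                    (trans (sym (desSubsetSingleton-inverse≡ r len)) (T⇒≡true des))
    ... | ordˡ , ordʳ = inOrder⇒shuffle low high r r-unique (trans len (sym length-low++high))
                          (subst (λ L → All (_∈ L) r) range≡low++high r⊆) ordˡ ordʳ low++high-unique

    shuffle⇒∈-inverseGrassmannian : ∀ {r} → r ∈ shuffles low high → r ∈ inverseGrassmannian (suc i₀) n
    shuffle⇒∈-inverseGrassmannian {r} r∈ =
      ∈-filter⁺ (λ r → T? (desSubsetSingleton (suc i₀) (inverse r)))
        (∈-Sym⁺ n r len (All.tabulate (λ {z} z∈ → subst (z ∈_) (sym range≡low++high) (∈-resp-↭ r↭ z∈)))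
          (Unique-resp-↭ (↭-sym r↭) low++high-unique))
        (subst T (sym (trans (desSubsetSingleton-inverse≡ r len)
                    (sorted⇒desFromOnly-++ 1 (pos 1 r) (positionsIn r (interval 2 i₀)) (positionsIn r high) (proj₁ ord) (proj₂ ord)))) tt)
      where
      r↭ : r ↭ low ++ high
      r↭ = ∈-shuffles⇒↭ low high r∈
      len : length r ≡ n
      len = trans (↭-length r↭) (trans (length-++ low) length-low++high)
      ord : InOrder low r × InOrder high r
      ord = shuffle⇒inOrder low high r∈ low++high-unique

    inverseGrassmannian↭shuffles : inverseGrassmannian (suc i₀) n ↭ shuffles low high
    inverseGrassmannian↭shuffles =
      unique-sameElements⇒↭ _ _
        (Unique.filter⁺ (λ r → T? (desSubsetSingleton (suc i₀) (inverse r))) (Sym-unique n))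
        (shuffles-unique low high low++high-unique)
        ∈-inverseGrassmannian⇒shuffle shuffle⇒∈-inverseGrassmannian

  countLess-++ : ∀ x a b → countLess x (a ++ b) ≡ countLess x a + countLess x b
  countLess-++ x [] b = refl
  countLess-++ x (y ∷ a) b with y <ᵇ x
  ... | true = cong suc (countLess-++ x a b)
  ... | false = countLess-++ x a b

  countLess-↭ : ∀ x {w w′} → w ↭ w′ → countLess x w ≡ countLess x w′
  countLess-↭ x _↭_.refl = refl
  countLess-↭ x (prep y p) with y <ᵇ x
  ... | true = cong suc (countLess-↭ x p)
  ... | false = countLess-↭ x p
  countLess-↭ x (swap y z p) with y <ᵇ x | z <ᵇ x
  ... | true | true = cong (suc ∘ suc) (countLess-↭ x p)
  ... | true | false = cong suc (countLess-↭ x p)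
  ... | false | true = cong suc (countLess-↭ x p)
  ... | false | false = countLess-↭ x p
  countLess-↭ x (_↭_.trans p q) = trans (countLess-↭ x p) (countLess-↭ x q)

  countLess-shuffle : ∀ x u v {w} → w ∈ shuffles u v → countLess x w ≡ countLess x u + countLess x v
  countLess-shuffle x u v w∈ = trans (countLess-↭ x (∈-shuffles⇒↭ u v w∈)) (countLess-++ x u v)

  countLess-interval : ∀ x lo m → x ≤ lo → countLess x (interval lo m) ≡ 0
  countLess-interval x lo zero _ = refl
  countLess-interval x lo (suc m) x≤lo rewrite ≥⇒<ᵇ≡false x≤lo = countLess-interval x (suc lo) m (m≤n⇒m≤1+n x≤lo)

  countLess-all< : ∀ y u → All (_< y) u → countLess y u ≡ length u
  countLess-all< y [] [] = refl
  countLess-all< y (x ∷ u) (x<y ∷ ps) rewrite <⇒<ᵇ≡true x<y = cong suc (countLess-all< y u ps)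

  invs-interval : ∀ lo m → invs (interval lo m) ≡ 0
  invs-interval lo zero = refl
  invs-interval lo (suc m) = cong₂ _+_ (countLess-interval lo (suc lo) m (n≤1+n lo)) (invs-interval (suc lo) m)

  invs-++-interval : ∀ lo (u : List ℕ) m → All (_< lo) u → invs (u ++ interval lo m) ≡ invs u
  invs-++-interval lo [] m [] = invs-interval lo m
  invs-++-interval lo (y ∷ u) m (y<lo ∷ ps) =
    cong₂ _+_ (trans (countLess-++ y u (interval lo m)) (trans (cong (countLess y u +_) (countLess-interval y lo m (<⇒≤ y<lo))) (+-identityʳ _)))
              (invs-++-interval lo u m ps)

  private
    rmajSum : ℕ → List ℕ → ℕ
    rmajSum L ds = foldr (λ j acc → (L ∸ j) + acc) 0 ds

    rmajSum-map-suc : ∀ L ds → rmajSum (suc L) (map suc ds) ≡ rmajSum L ds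
    rmajSum-map-suc L [] = refl
    rmajSum-map-suc L (d ∷ ds) = cong ((L ∸ d) +_) (rmajSum-map-suc L ds)

  desFrom-suc : ∀ d l → desFrom (suc d) l ≡ map suc (desFrom d l)
  desFrom-suc d [] = refl
  desFrom-suc d (x ∷ []) = refl
  desFrom-suc d (x ∷ y ∷ l) = consIf (y <ᵇ x) (desFrom-suc (suc d) (y ∷ l))
    where
    consIf : ∀ {A B} b → A ≡ map suc B → (if b then suc d ∷ A else A) ≡ map suc (if b then d ∷ B else B)
    consIf true e = cong (suc d ∷_) e
    consIf false e = e

  private
    rmajSum-desFrom-2 : ∀ w → rmajSum (suc (length w)) (desFrom 2 w) ≡ rmaj w
    rmajSum-desFrom-2 w = trans (cong (rmajSum (suc (length w))) (desFrom-suc 1 w)) (rmajSum-map-suc _ (desFrom 1 w))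

  rmajHead : ℕ → List ℕ → ℕ
  rmajHead x [] = 0
  rmajHead x (y ∷ w) = if y <ᵇ x then length (y ∷ w) else 0

  rmaj-∷ : ∀ x w → rmaj (x ∷ w) ≡ rmajHead x w + rmaj w
  rmaj-∷ x [] = refl
  rmaj-∷ x (y ∷ w) with y <ᵇ x
  ... | true = cong (length (y ∷ w) +_) (rmajSum-desFrom-2 (y ∷ w))
  ... | false = rmajSum-desFrom-2 (y ∷ w)

  rmajHead-interval : ∀ x lo m → x ≤ lo → rmajHead x (interval lo m) ≡ 0
  rmajHead-interval x lo zero _ = refl
  rmajHead-interval x lo (suc m) x≤lo rewrite ≥⇒<ᵇ≡false x≤lo = refl

  rmaj-interval : ∀ lo m → rmaj (interval lo m) ≡ 0
  rmaj-interval lo zero = refl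
  rmaj-interval lo (suc m) =
    trans (rmaj-∷ lo (interval (suc lo) m)) (cong₂ _+_ (rmajHead-interval lo (suc lo) m (n≤1+n lo)) (rmaj-interval (suc lo) m))

  -- The factorisation w = w₁ ⋯ w_{n-1}

  s-fixes : ∀ j x → x ≢ j → x ≢ suc j → s j x ≡ x
  s-fixes j x x≢j x≢1+j rewrite ≢⇒≡ᵇ≡false x≢j | ≢⇒≡ᵇ≡false x≢1+j = refl

  s-j≡1+j : ∀ j → s j j ≡ suc j
  s-j≡1+j j rewrite ≡ᵇ-refl j = refl

  s-1+j≡j : ∀ j → s j (suc j) ≡ j
  s-1+j≡j j rewrite ≢⇒≡ᵇ≡false {suc j} {j} (<⇒≢ (n<1+n j) ∘ sym) | ≡ᵇ-refl j = refl

  -- cyc (p + k) k is the cycle moving p+1 to p+k+1 and shifting p+2, …, p+k+1 down by one.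
  cyc-below : ∀ k p j → j ≡ p + k → ∀ x → x ≤ p → cyc j k x ≡ x
  cyc-below zero p j _ x _ = refl
  cyc-below (suc k) p zero j≡ _ _ = ⊥-elim (0≢1+n (trans j≡ (+-suc p k)))
  cyc-below (suc k) p (suc j) j≡ x x≤p =
    trans (cong (s (suc j)) (cyc-below k p j j≡′ x x≤p)) (s-fixes (suc j) x (<⇒≢ x<1+j) (<⇒≢ (m<n⇒m<1+n x<1+j)))
    where
    j≡′ : j ≡ p + k
    j≡′ = suc-injective (trans j≡ (+-suc p k))
    x<1+j : x < suc j
    x<1+j = s≤s (≤-trans x≤p (subst (p ≤_) (sym j≡′) (m≤m+n p k)))

  cyc-above : ∀ k j x → suc j < x → cyc j k x ≡ x
  cyc-above zero j x _ = refl
  cyc-above (suc k) j x 1+j<x =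
    trans (cong (s j) (cyc-above k (j ∸ 1) x (<-≤-trans (s≤s (s≤s (m∸n≤m j 1))) 1+j<x)))
          (s-fixes j x (<⇒≢ (<-trans (n<1+n j) 1+j<x) ∘ sym) (<⇒≢ 1+j<x ∘ sym))

  cyc-start : ∀ k p j → j ≡ p + k → cyc j k (suc p) ≡ suc j
  cyc-start zero p j j≡ = cong suc (sym (trans j≡ (+-identityʳ p)))
  cyc-start (suc k) p zero j≡ = ⊥-elim (0≢1+n (trans j≡ (+-suc p k)))
  cyc-start (suc k) p (suc j) j≡ =
    trans (cong (s (suc j)) (cyc-start k p j (suc-injective (trans j≡ (+-suc p k))))) (s-j≡1+j (suc j))

  cyc-shift : ∀ k p j → j ≡ p + k → ∀ d → d < k → cyc j k (suc (suc (p + d))) ≡ suc (p + d)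
  cyc-shift (suc k) p zero j≡ _ _ = ⊥-elim (0≢1+n (trans j≡ (+-suc p k)))
  cyc-shift (suc k) p (suc j) j≡ d d<1+k with m<1+n⇒m<n∨m≡n d<1+k
  ... | inj₁ d<k = trans (cong (s (suc j)) (cyc-shift k p j j≡′ d d<k)) (s-fixes (suc j) _ (<⇒≢ lt) (<⇒≢ (m<n⇒m<1+n lt)))
    where
    j≡′ : j ≡ p + k
    j≡′ = suc-injective (trans j≡ (+-suc p k))
    lt : suc (p + d) < suc j
    lt = s≤s (subst (p + d <_) (sym j≡′) (+-monoʳ-< p d<k))
  ... | inj₂ refl = trans (cong (s (suc j)) (cyc-above d j _ (s≤s (s≤s (≤-reflexive j≡′)))))
                      (trans (cong (λ z → s (suc j) (suc (suc z))) (sym j≡′)) (trans (s-1+j≡j (suc j)) (cong suc j≡′)))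
    where
    j≡′ : j ≡ p + d
    j≡′ = suc-injective (trans j≡ (+-suc p d))

  cyc-oneLine : ∀ p k j → j ≡ p + k → map (cyc j k) (interval 1 (suc j)) ≡ insertAt p (suc j) (interval 1 j)
  cyc-oneLine p k j j≡ = begin
      map (cyc j k) (interval 1 (suc j))
    ≡⟨ cong (λ z → map (cyc j k) (interval 1 z)) (trans (cong suc j≡) (sym (+-suc p k))) ⟩
      map (cyc j k) (interval 1 (p + suc k))
    ≡⟨ cong (map (cyc j k)) (interval-++ 1 p (suc k)) ⟩
      map (cyc j k) (interval 1 p ++ suc p ∷ interval (suc (suc p)) k)
    ≡⟨ map-++ (cyc j k) (interval 1 p) _ ⟩
      map (cyc j k) (interval 1 p) ++ cyc j k (suc p) ∷ map (cyc j k) (interval (suc (suc p)) k)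
    ≡⟨ cong₂ _++_ (map-interval (cyc j k) 1 1 p (λ d d<p → cyc-below k p j j≡ (suc d) d<p))
                  (cong₂ _∷_ (cyc-start k p j j≡) (map-interval (cyc j k) (suc (suc p)) (suc p) k (cyc-shift k p j j≡))) ⟩
      interval 1 p ++ suc j ∷ interval (suc p) k
    ≡⟨ ++-∷≡insertAt (interval 1 p) (interval (suc p) k) (suc j) ⟩
      insertAt (length (interval 1 p)) (suc j) (interval 1 p ++ interval (suc p) k)
    ≡⟨ cong₂ (λ a b → insertAt a (suc j) b) (length-interval 1 p) (sym (trans (cong (interval 1) j≡) (interval-++ 1 p k))) ⟩
      insertAt p (suc j) (interval 1 j) ∎
    where open ≡-Reasoning

  prodFrom-∷ʳ : ∀ j ks k x → prodFrom j (ks ++ [ k ]) x ≡ prodFrom j ks (cyc (j + length ks) k x)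
  prodFrom-∷ʳ j [] k x = cong (λ z → cyc z k x) (sym (+-identityʳ j))
  prodFrom-∷ʳ j (k′ ∷ ks) k x =
    cong (cyc j k′) (trans (prodFrom-∷ʳ (suc j) ks k x) (cong (λ z → prodFrom (suc j) ks (cyc z k x)) (sym (+-suc j (length ks)))))

  prodFrom-fixesAbove : ∀ d ks x → d + length ks < x → prodFrom d ks x ≡ x
  prodFrom-fixesAbove d [] x _ = refl
  prodFrom-fixesAbove d (k ∷ ks) x lt =
    trans (cong (cyc d k) (prodFrom-fixesAbove (suc d) ks x lt′)) (cyc-above k d x (≤-<-trans (s≤s (m≤m+n d (length ks))) lt′))
    where lt′ = subst (_< x) (+-suc d (length ks)) lt

  s-≤ : ∀ j x B → x ≤ B → j < B → s j x ≤ B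
  s-≤ j x B x≤B j<B with x ≡ᵇ j
  ... | true = j<B
  ... | false with x ≡ᵇ suc j
  ... | true = <⇒≤ j<B
  ... | false = x≤B

  cyc-≤ : ∀ j k x B → x ≤ B → j < B → cyc j k x ≤ B
  cyc-≤ j zero x B x≤B _ = x≤B
  cyc-≤ j (suc k) x B x≤B j<B = s-≤ j _ B (cyc-≤ (j ∸ 1) k x B x≤B (≤-<-trans (m∸n≤m j 1) j<B)) j<B

  prodFrom-≤ : ∀ d ks x B → x ≤ B → d + length ks ≤ B → prodFrom d ks x ≤ B
  prodFrom-≤ d [] x B x≤B _ = x≤B
  prodFrom-≤ d (k ∷ ks) x B x≤B le =
    cyc-≤ d k _ B (prodFrom-≤ (suc d) ks x B x≤B le′) (≤-<-trans (m≤m+n d (length ks)) le′)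
    where le′ = subst (_≤ B) (+-suc d (length ks)) le

  length-tupleWord : ∀ n ks → length (tupleWord n ks) ≡ n
  length-tupleWord n ks = trans (length-map (prodFrom 1 ks) (range n)) (trans (cong length (range≡interval n)) (length-interval 1 n))

  tupleWord-∷ʳ : ∀ m ks k → length ks ≡ m → k ≤ suc m →
    tupleWord (suc (suc m)) (ks ++ [ k ]) ≡ insertAt (suc m ∸ k) (suc (suc m)) (tupleWord (suc m) ks)
  tupleWord-∷ʳ m ks k len k≤ = begin
      map (prodFrom 1 (ks ++ [ k ])) (range (suc (suc m)))
    ≡⟨ cong (map (prodFrom 1 (ks ++ [ k ]))) (range≡interval (suc (suc m))) ⟩
      map (prodFrom 1 (ks ++ [ k ])) (interval 1 (suc (suc m)))
    ≡⟨ map-cong (λ x → trans (prodFrom-∷ʳ 1 ks k x) (cong (λ z → prodFrom 1 ks (cyc (suc z) k x)) len)) (interval 1 (suc (suc m))) ⟩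
      map (prodFrom 1 ks ∘ cyc (suc m) k) (interval 1 (suc (suc m)))
    ≡⟨ map-∘ (interval 1 (suc (suc m))) ⟩
      map (prodFrom 1 ks) (map (cyc (suc m) k) (interval 1 (suc (suc m))))
    ≡⟨ cong (map (prodFrom 1 ks)) (cyc-oneLine (suc m ∸ k) k (suc m) (sym (m∸n+n≡m k≤))) ⟩
      map (prodFrom 1 ks) (insertAt (suc m ∸ k) (suc (suc m)) (interval 1 (suc m)))
    ≡⟨ map-insertAt (prodFrom 1 ks) (suc m ∸ k) (suc (suc m)) (interval 1 (suc m))
         (subst (suc m ∸ k ≤_) (sym (length-interval 1 (suc m))) (m∸n≤m (suc m) k)) ⟩
      insertAt (suc m ∸ k) (prodFrom 1 ks (suc (suc m))) (map (prodFrom 1 ks) (interval 1 (suc m)))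
    ≡⟨ cong₂ (insertAt (suc m ∸ k)) (prodFrom-fixesAbove 1 ks (suc (suc m)) (s≤s (s≤s (≤-reflexive len))))
                                   (cong (map (prodFrom 1 ks)) (sym (range≡interval (suc m)))) ⟩
      insertAt (suc m ∸ k) (suc (suc m)) (tupleWord (suc m) ks) ∎
    where open ≡-Reasoning

  tupleWord-≤ : ∀ m ks → length ks ≡ m → All (_≤ suc m) (tupleWord (suc m) ks)
  tupleWord-≤ m ks len = All.map⁺ (subst (All (λ x → prodFrom 1 ks x ≤ suc m)) (sym (range≡interval (suc m))) (bounded 1 (suc m) ≤-refl))
    where
    bounded : ∀ lo n → lo + n ≤ suc (suc m) → All (λ x → prodFrom 1 ks x ≤ suc m) (interval lo n)
    bounded lo zero _ = []
    bounded lo (suc n) le =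
      prodFrom-≤ 1 ks lo (suc m) (≤-pred (≤-trans (s≤s (m≤m+n lo n)) le′)) (s≤s (≤-reflexive len)) ∷ bounded (suc lo) n le′
      where le′ = subst (_≤ suc (suc m)) (+-suc lo n) le

  ∈-tuples-∷ʳ⁺ : ∀ m {ks} k → ks ∈ tuples m → k < suc (suc m) → ks ++ [ k ] ∈ tuples (suc m)
  ∈-tuples-∷ʳ⁺ m {ks} k ks∈ k< =
    ∈-concatMap⁺ (λ ks → map (λ k → ks ++ (k ∷ [])) (upTo (suc (suc m))))
      (lose ks∈ (∈-map⁺ (λ k → ks ++ (k ∷ [])) (∈-applyUpTo⁺ (λ z → z) k<)))

  ∈-tuples-∷ʳ⁻ : ∀ m {ks′} → ks′ ∈ tuples (suc m) →
    Σ (List ℕ) λ ks → Σ ℕ λ k → ks ∈ tuples m × k < suc (suc m) × ks′ ≡ ks ++ [ k ]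
  ∈-tuples-∷ʳ⁻ m ks′∈ with find (∈-concatMap⁻ (λ ks → map (λ k → ks ++ (k ∷ [])) (upTo (suc (suc m)))) ks′∈)
  ... | ks , ks∈ , ks′∈ᵏ with ∈-map⁻ (λ k → ks ++ (k ∷ [])) ks′∈ᵏ
  ... | k , k∈ , refl with ∈-applyUpTo⁻ (λ z → z) k∈
  ... | _ , k< , refl = ks , k , ks∈ , k< , refl

  ∈-tuples⇒length : ∀ m {ks} → ks ∈ tuples m → length ks ≡ m
  ∈-tuples⇒length zero (here refl) = refl
  ∈-tuples⇒length (suc m) ks′∈ with ∈-tuples-∷ʳ⁻ m ks′∈
  ... | ks , k , ks∈ , _ , refl = trans (length-++ ks) (trans (+-comm (length ks) 1) (cong suc (∈-tuples⇒length m ks∈)))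

  tupleWord-injective : ∀ m {ks ks′} → ks ∈ tuples m → ks′ ∈ tuples m → tupleWord (suc m) ks ≡ tupleWord (suc m) ks′ → ks ≡ ks′
  tupleWord-injective zero (here refl) (here refl) _ = refl
  tupleWord-injective (suc m) ∈₁ ∈₂ e with ∈-tuples-∷ʳ⁻ m ∈₁ | ∈-tuples-∷ʳ⁻ m ∈₂
  ... | a , k , a∈ , k< , refl | a′ , k′ , a′∈ , k′< , refl =
    cong₂ (λ x y → x ++ [ y ]) (tupleWord-injective m a∈ a′∈ (proj₂ inserted)) (∸-cancelˡ-≡ (≤-pred k<) (≤-pred k′<) (proj₁ inserted))
    where
    la : length a ≡ m
    la = ∈-tuples⇒length m a∈
    la′ : length a′ ≡ m
    la′ = ∈-tuples⇒length m a′∈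
    top∉ : ∀ {b} → length b ≡ m → suc (suc m) ∉ tupleWord (suc m) b
    top∉ {b} lb top∈ = <-irrefl refl (All.lookup (tupleWord-≤ m b lb) top∈)
    inserted : suc m ∸ k ≡ suc m ∸ k′ × tupleWord (suc m) a ≡ tupleWord (suc m) a′
    inserted = insertAt-injective (suc m ∸ k) (suc m ∸ k′) (suc (suc m)) (tupleWord (suc m) a) (tupleWord (suc m) a′)
      (subst (suc m ∸ k ≤_) (sym (length-tupleWord (suc m) a)) (m∸n≤m (suc m) k))
      (subst (suc m ∸ k′ ≤_) (sym (length-tupleWord (suc m) a′)) (m∸n≤m (suc m) k′))
      (top∉ {a} la) (top∉ {a′} la′)
      (trans (sym (tupleWord-∷ʳ m a k la (≤-pred k<))) (trans e (tupleWord-∷ʳ m a′ k′ la′ (≤-pred k′<))))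

  findTuple-unique : ∀ n w (L : List (List ℕ)) ks → ks ∈ L → tupleWord n ks ≡ w →
    (∀ {ks′} → ks′ ∈ L → tupleWord n ks′ ≡ w → ks′ ≡ ks) → findTuple n w L ≡ ks
  findTuple-unique n w (ks′ ∷ L) ks ks∈ e unique with ≡-dec _≟_ (tupleWord n ks′) w
  ... | yes e′ = unique (here refl) e′
  ... | no ne with ks∈
  ... | here refl = ⊥-elim (ne e)
  ... | there ks∈L = findTuple-unique n w L ks ks∈L e (unique ∘ there)

  factorTuple-tupleWord : ∀ m ks w → ks ∈ tuples m → tupleWord (suc m) ks ≡ w → factorTuple w ≡ ks
  factorTuple-tupleWord m ks w ks∈ e = subst (λ L → findTuple L w (tuples (L ∸ 1)) ≡ ks) (sym lw)
    (findTuple-unique (suc m) w (tuples m) ks ks∈ e (λ ks′∈ e′ → tupleWord-injective m ks′∈ ks∈ (trans e′ (sym e))))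
    where
    lw : length w ≡ suc m
    lw = trans (cong length (sym e)) (length-tupleWord (suc m) ks)

  tupleWord-surjective : ∀ m u → u ↭ interval 1 (suc m) → Σ (List ℕ) λ ks → ks ∈ tuples m × tupleWord (suc m) ks ≡ u
  tupleWord-surjective zero u p with ↭-singleton-inv p
  ... | refl = [] , here refl , refl
  tupleWord-surjective (suc m) u p with ∈-∃++ (∈-resp-↭ (↭-sym p) (subst (suc (suc m) ∈_) (sym (interval-∷ʳ 1 (suc m))) (∈-++⁺ʳ (interval 1 (suc m)) (here refl))))
  ... | A , B , refl with tupleWord-surjective m (A ++ B) A++B↭
    where
    A++B↭ : A ++ B ↭ interval 1 (suc m)
    A++B↭ = subst (A ++ B ↭_) (++-identityʳ (interval 1 (suc m)))
              (drop-mid A (interval 1 (suc m)) (subst (A ++ suc (suc m) ∷ B ↭_) (interval-∷ʳ 1 (suc m)) p))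
  ... | ks , ks∈ , e = ks ++ [ suc m ∸ length A ] , ∈-tuples-∷ʳ⁺ m (suc m ∸ length A) ks∈ (s≤s (m∸n≤m (suc m) (length A))) , inserted
    where
    lA : length A ≤ suc m
    lA = subst (length A ≤_) (trans (cong length (sym e)) (length-tupleWord (suc m) ks))
           (subst (length A ≤_) (sym (length-++ A)) (m≤m+n (length A) (length B)))
    inserted : tupleWord (suc (suc m)) (ks ++ [ suc m ∸ length A ]) ≡ A ++ suc (suc m) ∷ B
    inserted = trans (tupleWord-∷ʳ m ks (suc m ∸ length A) (∈-tuples⇒length m ks∈) (m∸n≤m (suc m) (length A)))
                 (trans (cong₂ (λ a b → insertAt a (suc (suc m)) b) (m∸[m∸n]≡n lA) e) (sym (++-∷≡insertAt A B (suc (suc m)))))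

  fullCycleFlags : List ℕ → ℕ → List Bool
  fullCycleFlags [] d = []
  fullCycleFlags (k ∷ ks) d = (k ≡ᵇ d) ∷ fullCycleFlags ks (suc d)

  fullCycleFlags-∷ʳ : ∀ ks k d → fullCycleFlags (ks ++ [ k ]) d ≡ fullCycleFlags ks d ++ [ k ≡ᵇ (d + length ks) ]
  fullCycleFlags-∷ʳ [] k d = cong (λ z → (k ≡ᵇ z) ∷ []) (sym (+-identityʳ d))
  fullCycleFlags-∷ʳ (k′ ∷ ks) k d =
    cong ((k′ ≡ᵇ d) ∷_) (trans (fullCycleFlags-∷ʳ ks k (suc d)) (cong (λ z → fullCycleFlags ks (suc d) ++ [ k ≡ᵇ z ]) (sym (+-suc d (length ks)))))

  length-fullCycleFlags : ∀ ks d → length (fullCycleFlags ks d) ≡ length ks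
  length-fullCycleFlags [] d = refl
  length-fullCycleFlags (k ∷ ks) d = cong suc (length-fullCycleFlags ks (suc d))

  -- the flags contributed by inserting m larger letters: only the first insertion can be a full cycle
  insertionFlags : ℕ → Bool → List Bool
  insertionFlags zero b = []
  insertionFlags (suc m) b = b ∷ replicate m false

  replicate-∷ʳ : ∀ m (b : Bool) → replicate m b ++ [ b ] ≡ b ∷ replicate m b
  replicate-∷ʳ zero b = refl
  replicate-∷ʳ (suc m) b = cong (b ∷_) (replicate-∷ʳ m b)

  insertionFlags-∷ʳ-false : ∀ m b → (m ≡ 0 → b ≡ false) → insertionFlags m b ++ [ false ] ≡ insertionFlags (suc m) b
  insertionFlags-∷ʳ-false zero b b≡false rewrite b≡false refl = refl
  insertionFlags-∷ʳ-false (suc m) b _ = cong (b ∷_) (replicate-∷ʳ m false)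

  module _ (i₀ : ℕ) (u ku : List ℕ) (ku∈ : ku ∈ tuples i₀) (ku↦u : tupleWord (suc i₀) ku ≡ u)
           (u-head : startsWith (suc (suc i₀)) u ≡ false) where
    private
      lo = suc (suc i₀)

    insertion-lastFlag : ∀ m p w → w ∈ shuffles u (interval lo m) → p ≤ length w → (p ≡ 0 → interval lo m ≡ []) →
      insertionFlags m (startsWith lo w) ++ [ (suc (m + i₀) ∸ p) ≡ᵇ suc (m + i₀) ]
      ≡ insertionFlags (suc m) (startsWith lo (insertAt p (lo + m) w))
    insertion-lastFlag zero zero w _ _ _ rewrite +-identityʳ i₀ | ≡ᵇ-refl i₀ = refl
    insertion-lastFlag (suc m) zero w _ _ p≡0⇒ with p≡0⇒ refl
    ... | ()
    insertion-lastFlag m (suc p) (a ∷ w) w∈ _ _ rewrite ≢⇒≡ᵇ≡false (<⇒≢ (s≤s (m∸n≤m (m + i₀) p))) =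
      insertionFlags-∷ʳ-false m (startsWith lo (a ∷ w)) headFalse
      where
      headFalse : m ≡ 0 → startsWith lo (a ∷ w) ≡ false
      headFalse refl = trans (cong (startsWith lo) (∈-shuffles-[]ʳ u w∈)) u-head

    -- Inserting lo + m at position p of a word of length N adds the factor with k = N ∸ p,
    -- which is a full cycle exactly when p = 0.
    shuffle-factorisation : ∀ m {w} → w ∈ shuffles u (interval lo m) →
      Σ (List ℕ) λ ks → ks ∈ tuples (m + i₀) × tupleWord (suc (m + i₀)) ks ≡ w
                        × fullCycleFlags ks 1 ≡ fullCycleFlags ku 1 ++ insertionFlags m (startsWith lo w)
    shuffle-factorisation zero w∈ rewrite ∈-shuffles-[]ʳ u w∈ = ku , ku∈ , ku↦u , sym (++-identityʳ _)
    shuffle-factorisation (suc m) {w} w∈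
      with ∈-shuffles-∷ʳ⁻ u (interval lo m) (lo + m) (subst (λ V → w ∈ shuffles u V) (interval-∷ʳ lo m) w∈)
    ... | w⁻ , p , w⁻∈ , refl , p≤ , p≡0⇒interval≡[] with shuffle-factorisation m w⁻∈
    ... | ks⁻ , ks⁻∈ , ks⁻↦w⁻ , flags⁻ =
      ks⁻ ++ [ N ∸ p ] , ∈-tuples-∷ʳ⁺ (m + i₀) (N ∸ p) ks⁻∈ (s≤s (m∸n≤m N p)) , inserted , flags
      where
      N = suc (m + i₀)
      len-ks⁻ : length ks⁻ ≡ m + i₀
      len-ks⁻ = ∈-tuples⇒length (m + i₀) ks⁻∈
      p≤N : p ≤ N
      p≤N = subst (p ≤_) (trans (cong length (sym ks⁻↦w⁻)) (length-tupleWord N ks⁻)) p≤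
      inserted : tupleWord (suc N) (ks⁻ ++ [ N ∸ p ]) ≡ insertAt p (lo + m) w⁻
      inserted = trans (tupleWord-∷ʳ (m + i₀) ks⁻ (N ∸ p) len-ks⁻ (m∸n≤m N p))
                   (trans (cong (insertAt (N ∸ (N ∸ p)) (suc N)) ks⁻↦w⁻)
                     (cong₂ (λ a b → insertAt a b w⁻) (m∸[m∸n]≡n p≤N) (cong (λ z → suc (suc z)) (+-comm m i₀))))
      flags : fullCycleFlags (ks⁻ ++ [ N ∸ p ]) 1 ≡ fullCycleFlags ku 1 ++ insertionFlags (suc m) (startsWith lo (insertAt p (lo + m) w⁻))
      flags = begin
          fullCycleFlags (ks⁻ ++ [ N ∸ p ]) 1
        ≡⟨ fullCycleFlags-∷ʳ ks⁻ (N ∸ p) 1 ⟩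
          fullCycleFlags ks⁻ 1 ++ [ (N ∸ p) ≡ᵇ suc (length ks⁻) ]
        ≡⟨ cong₂ (λ F k → F ++ [ (N ∸ p) ≡ᵇ suc k ]) flags⁻ len-ks⁻ ⟩
          (fullCycleFlags ku 1 ++ insertionFlags m (startsWith lo w⁻)) ++ [ (N ∸ p) ≡ᵇ N ]
        ≡⟨ ++-assoc (fullCycleFlags ku 1) _ _ ⟩
          fullCycleFlags ku 1 ++ insertionFlags m (startsWith lo w⁻) ++ [ (N ∸ p) ≡ᵇ N ]
        ≡⟨ cong (fullCycleFlags ku 1 ++_) (insertion-lastFlag m p w⁻ w⁻∈ p≤ p≡0⇒interval≡[]) ⟩
          fullCycleFlags ku 1 ++ insertionFlags (suc m) (startsWith lo (insertAt p (lo + m) w⁻)) ∎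
        where open ≡-Reasoning

  map-app-∷ : ∀ y (L : List ℕ) lo k → map (app (y ∷ L)) (interval (suc (suc lo)) k) ≡ map (app L) (interval (suc lo) k)
  map-app-∷ y L lo zero = refl
  map-app-∷ y L lo (suc k) = cong (app L (suc lo) ∷_) (map-app-∷ y L (suc lo) k)

  map-app-++-prefix : ∀ (u v : List ℕ) → map (app (u ++ v)) (interval 1 (length u)) ≡ u
  map-app-++-prefix [] v = refl
  map-app-++-prefix (y ∷ u) v = cong (y ∷_) (trans (map-app-∷ y (u ++ v) 0 (length u)) (map-app-++-prefix u v))

  app-++ : ∀ (u v : List ℕ) j → app (u ++ v) (suc (length u + j)) ≡ app v (suc j)
  app-++ [] v j = refl
  app-++ (y ∷ u) v j = app-++ u v j

  app-interval : ∀ lo m j → j < m → app (interval lo m) (suc j) ≡ lo + j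
  app-interval lo (suc m) zero _ = sym (+-identityʳ lo)
  app-interval lo (suc m) (suc j) (s≤s j<m) = trans (app-interval (suc lo) m j j<m) (sym (+-suc lo j))

  map-app-++-interval : ∀ (u : List ℕ) m →
    map (app (u ++ interval (suc (length u)) m)) (interval (suc (length u)) m) ≡ interval (suc (length u)) m
  map-app-++-interval u m = map-interval (app (u ++ interval (suc (length u)) m)) (suc (length u)) (suc (length u)) m
    (λ d d<m → trans (app-++ u (interval (suc (length u)) m) d) (app-interval (suc (length u)) m d d<m))

  take-length-++ : ∀ (u v : List ℕ) → take (length u) (u ++ v) ≡ u
  take-length-++ [] v = refl
  take-length-++ (y ∷ u) v = cong (y ∷_) (take-length-++ u v)

  app-drop : ∀ i (L : List ℕ) j → i ≤ length L → app (drop i L) (suc j) ≡ app L (suc (i + j))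
  app-drop zero L j _ = refl
  app-drop (suc i) (y ∷ L) j (s≤s i≤) = app-drop i L j i≤

  app≗⇒≡interval : ∀ (D : List ℕ) lo m → length D ≡ m → (∀ j → j < m → app D (suc j) ≡ lo + j) → D ≡ interval lo m
  app≗⇒≡interval [] lo zero _ _ = refl
  app≗⇒≡interval (d ∷ D) lo (suc m) len D≗ = cong₂ _∷_ (trans (D≗ 0 (s≤s z≤n)) (+-identityʳ lo))
    (app≗⇒≡interval D (suc lo) m (suc-injective len) (λ j j<m → trans (D≗ (suc j) (s≤s j<m)) (+-suc lo j)))

  fixedAbove⇒≡take++interval : ∀ i m (σ : List ℕ) → length σ ≡ i + m →
    (∀ k → 1 ≤ k → k ≤ i + m → app σ k ≢ k → k ≤ i) → σ ≡ take i σ ++ interval (suc i) m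
  fixedAbove⇒≡take++interval i m σ len supp = trans (sym (take++drop≡id i σ)) (cong (take i σ ++_) dropped)
    where
    fixed : ∀ j → j < m → app σ (suc (i + j)) ≡ suc (i + j)
    fixed j j<m with app σ (suc (i + j)) ≟ suc (i + j)
    ... | yes e = e
    ... | no ne = ⊥-elim (<-irrefl refl (≤-trans (s≤s (m≤m+n i j)) (supp (suc (i + j)) (s≤s z≤n) (+-monoʳ-< i j<m) ne)))
    dropped : drop i σ ≡ interval (suc i) m
    dropped = app≗⇒≡interval (drop i σ) (suc i) m (trans (length-drop i σ) (trans (cong (_∸ i) len) (m+n∸m≡n i m)))
      (λ j j<m → trans (app-drop i σ j (subst (i ≤_) (sym len) (m≤m+n i m))) (fixed j j<m))

  -- i, n and σ are returned as equations, so that matching on refl puts the theorem in this shape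
  decompose-supportedIn : ∀ n i → 1 ≤ i → i ≤ n → (σ : List ℕ) → σ ↭ range n →
    (∀ k → 1 ≤ k → k ≤ n → app σ k ≢ k → k ≤ i) →
    Σ ℕ λ x → Σ (List ℕ) λ xs → Σ ℕ λ m →
      i ≡ suc (length xs) × n ≡ suc (length xs) + m × σ ≡ (x ∷ xs) ++ interval (suc (suc (length xs))) m
      × (x ∷ xs ↭ interval 1 (suc (length xs)))
  decompose-supportedIn n (suc i₀) (s≤s z≤n) i≤n σ σ↭ supp with m≤n⇒∃[o]m+o≡n i≤n
  ... | m , refl = split (take (suc i₀) σ) prefix↭ σ≡
    where
    high = interval (suc (suc i₀)) m
    σ≡ : σ ≡ take (suc i₀) σ ++ high
    σ≡ = fixedAbove⇒≡take++interval (suc i₀) m σ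
           (trans (↭-length σ↭) (trans (cong length (range≡interval (suc i₀ + m))) (length-interval 1 (suc i₀ + m)))) supp
    prefix↭ : take (suc i₀) σ ↭ interval 1 (suc i₀)
    prefix↭ = ↭-cancelʳ _ _ high (subst₂ _↭_ σ≡ (trans (range≡interval (suc i₀ + m)) (interval-++ 1 (suc i₀) m)) σ↭)
    split : ∀ u → u ↭ interval 1 (suc i₀) → σ ≡ u ++ high →
      Σ ℕ λ x → Σ (List ℕ) λ xs → Σ ℕ λ m′ →
        suc i₀ ≡ suc (length xs) × suc i₀ + m ≡ suc (length xs) + m′ × σ ≡ (x ∷ xs) ++ interval (suc (suc (length xs))) m′
        × (x ∷ xs ↭ interval 1 (suc (length xs)))
    split [] u↭ _ with ↭-length u↭
    ... | ()
    split (x ∷ xs) u↭ σ≡′ =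
      x , xs , m , cong suc (sym lx) , cong (λ k → suc k + m) (sym lx) ,
      subst (λ k → σ ≡ x ∷ xs ++ interval (suc (suc k)) m) (sym lx) σ≡′ , subst (λ k → x ∷ xs ↭ interval 1 (suc k)) (sym lx) u↭
      where
      lx : length xs ≡ i₀
      lx = suc-injective (trans (↭-length u↭) (length-interval 1 (suc i₀)))

  module _ {ℓ₁ ℓ₂} (R : CommutativeRing ℓ₁ ℓ₂) where
    private module R = CommutativeRing R
    open R using (Carrier; _≈_; 0#; 1#)
      renaming (_+_ to _⊕_; _*_ to _⊛_; refl to ≈-refl; sym to ≈-sym; trans to ≈-trans; reflexive to ≈-reflexive)
    open RingDefs R
    open import Relation.Binary.Reasoning.Setoid R.setoid
    open import Algebra.Solver.Ring.NaturalCoefficients.Default R.commutativeSemiring using (solve; _:=_; _:+_; _:*_; con)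

    sumR-++ : ∀ xs ys → sumR (xs ++ ys) ≈ sumR xs ⊕ sumR ys
    sumR-++ [] ys = ≈-sym (R.+-identityˡ _)
    sumR-++ (x ∷ xs) ys = ≈-trans (R.+-congˡ (sumR-++ xs ys)) (≈-sym (R.+-assoc _ _ _))

    sumR-map-↭ : ∀ {A : Set} (F : A → Carrier) {xs ys} → xs ↭ ys → sumR (map F xs) ≈ sumR (map F ys)
    sumR-map-↭ F p = ↭ₛ.foldr-commMonoid R.setoid R.+-isCommutativeMonoid (↭⇒↭ₛ′ R.isEquivalence (↭.map⁺ F p))

    sumR-map-cong : ∀ {A : Set} (F G : A → Carrier) (L : List A) → (∀ {w} → w ∈ L → F w ≈ G w) →
      sumR (map F L) ≈ sumR (map G L)
    sumR-map-cong F G [] _ = ≈-refl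
    sumR-map-cong F G (w ∷ L) F≈G = R.+-cong (F≈G (here refl)) (sumR-map-cong F G L (F≈G ∘ there))

    sumR-map-*ˡ : ∀ {A : Set} (k : Carrier) (F : A → Carrier) (L : List A) →
      sumR (map (λ w → k ⊛ F w) L) ≈ k ⊛ sumR (map F L)
    sumR-map-*ˡ k F [] = ≈-sym (R.zeroʳ k)
    sumR-map-*ˡ k F (w ∷ L) = ≈-trans (R.+-congˡ (sumR-map-*ˡ k F L)) (≈-sym (R.distribˡ k _ _))

    shuffleSum-∷-∷ : ∀ (F : List ℕ → Carrier) x xs y ys →
      sumR (map F (shuffles (x ∷ xs) (y ∷ ys)))
      ≈ sumR (map (F ∘ (x ∷_)) (shuffles xs (y ∷ ys))) ⊕ sumR (map (F ∘ (y ∷_)) (shuffles (x ∷ xs) ys))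
    shuffleSum-∷-∷ F x xs y ys = begin
        sumR (map F (map (x ∷_) L₁ ++ map (y ∷_) L₂))
      ≡⟨ cong sumR (map-++ F (map (x ∷_) L₁) (map (y ∷_) L₂)) ⟩
        sumR (map F (map (x ∷_) L₁) ++ map F (map (y ∷_) L₂))
      ≈⟨ sumR-++ (map F (map (x ∷_) L₁)) _ ⟩
        sumR (map F (map (x ∷_) L₁)) ⊕ sumR (map F (map (y ∷_) L₂))
      ≡⟨ cong₂ (λ A B → sumR A ⊕ sumR B) (sym (map-∘ L₁)) (sym (map-∘ L₂)) ⟩
        sumR (map (F ∘ (x ∷_)) L₁) ⊕ sumR (map (F ∘ (y ∷_)) L₂) ∎
      where
      L₁ = shuffles xs (y ∷ ys)
      L₂ = shuffles (x ∷ xs) ys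

    weight : ℕ → Carrier → List ℕ → Carrier
    weight lo z w = if startsWith lo w then z else 1#

    pow-+ : ∀ x a b → pow x (a + b) ≈ pow x a ⊛ pow x b
    pow-+ x zero b = ≈-sym (R.*-identityˡ _)
    pow-+ x (suc a) b = ≈-trans (R.*-congˡ (pow-+ x a b)) (≈-sym (R.*-assoc _ _ _))

    module _ (q : Carrier) where

      sumR-pow-shift : ∀ {A : Set} (S T : A → ℕ) k L → (∀ {w} → w ∈ L → S w ≡ k + T w) →
        sumR (map (pow q ∘ S) L) ≈ pow q k ⊛ sumR (map (pow q ∘ T) L)
      sumR-pow-shift S T k L S≡ =
        ≈-trans (sumR-map-cong (pow q ∘ S) (λ w → pow q k ⊛ pow q (T w)) L
                  (λ w∈ → ≈-trans (≈-reflexive (cong (pow q) (S≡ w∈))) (pow-+ q k _)))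
                (sumR-map-*ˡ (pow q k) (pow q ∘ T) L)

      qbin-vanish : ∀ n k → n < k → qbin q n k ≈ 0#
      qbin-vanish zero (suc k) _ = ≈-refl
      qbin-vanish (suc n) (suc k) (s≤s n<k) = begin
          qbin q n k ⊕ pow q (suc k) ⊛ qbin q n (suc k)
        ≈⟨ R.+-cong (qbin-vanish n k n<k) (R.*-congˡ (qbin-vanish n (suc k) (m<n⇒m<1+n n<k))) ⟩
          0# ⊕ pow q (suc k) ⊛ 0#
        ≈⟨ ≈-trans (R.+-identityˡ _) (R.zeroʳ _) ⟩
          0# ∎

      qbin-diagonal : ∀ n → qbin q n n ≈ 1#
      qbin-diagonal zero = ≈-refl
      qbin-diagonal (suc n) = begin
          qbin q n n ⊕ pow q (suc n) ⊛ qbin q n (suc n)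
        ≈⟨ R.+-cong (qbin-diagonal n) (R.*-congˡ (qbin-vanish n (suc n) ≤-refl)) ⟩
          1# ⊕ pow q (suc n) ⊛ 0#
        ≈⟨ ≈-trans (R.+-congˡ (R.zeroʳ _)) (R.+-identityʳ _) ⟩
          1# ∎

      qbin-dual-pascal : ∀ k e → qbin q (suc (k + e)) (suc k) ≈ pow q e ⊛ qbin q (k + e) k ⊕ qbin q (k + e) (suc k)
      qbin-dual-pascal k zero rewrite +-identityʳ k = begin
          qbin q (suc k) (suc k)
        ≈⟨ qbin-diagonal (suc k) ⟩
          1#
        ≈⟨ ≈-sym (≈-trans (R.+-identityʳ _) (R.*-identityˡ _)) ⟩
          1# ⊛ 1# ⊕ 0#
        ≈⟨ R.+-cong (R.*-congˡ (≈-sym (qbin-diagonal k))) (≈-sym (qbin-vanish k (suc k) ≤-refl)) ⟩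
          1# ⊛ qbin q k k ⊕ qbin q k (suc k) ∎
      qbin-dual-pascal zero (suc e) = begin
          1# ⊕ (q ⊛ 1#) ⊛ qbin q (suc e) 1
        ≈⟨ R.+-congˡ (R.*-cong (R.*-identityʳ q) (≈-trans (qbin-dual-pascal zero e) (R.+-congʳ (R.*-identityʳ _)))) ⟩
          1# ⊕ q ⊛ (pow q e ⊕ qbin q e 1)
        ≈⟨ solve 4 (λ O q E b → (O :+ q :* (E :+ b)) := (q :* E :+ (O :+ q :* b))) ≈-refl 1# q (pow q e) (qbin q e 1) ⟩
          q ⊛ pow q e ⊕ (1# ⊕ q ⊛ qbin q e 1)
        ≈⟨ ≈-sym (R.+-cong (R.*-identityʳ _) (R.+-congˡ (R.*-congʳ (R.*-identityʳ q)))) ⟩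
          (q ⊛ pow q e) ⊛ 1# ⊕ (1# ⊕ (q ⊛ 1#) ⊛ qbin q e 1) ∎
      qbin-dual-pascal (suc k) (suc e) = begin
          qbin q (suc N) (suc k) ⊕ (q ⊛ X) ⊛ qbin q (suc N) (suc (suc k))
        ≈⟨ R.+-cong (qbin-dual-pascal k (suc e)) (R.*-congˡ shifted) ⟩
          (q ⊛ E ⊛ a ⊕ b) ⊕ (q ⊛ X) ⊛ (E ⊛ b ⊕ c)
        ≈⟨ solve 6 (λ q E X a b c → ((q :* E :* a :+ b) :+ (q :* X) :* (E :* b :+ c))
                                    := ((q :* E) :* (a :+ X :* b) :+ (b :+ (q :* X) :* c))) ≈-refl q E X a b c ⟩
          (q ⊛ E) ⊛ (a ⊕ X ⊛ b) ⊕ (b ⊕ (q ⊛ X) ⊛ c) ∎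
        where
        N = k + suc e
        a = qbin q N k
        b = qbin q N (suc k)
        c = qbin q N (suc (suc k))
        X = pow q (suc k)
        E = pow q e
        shifted : qbin q (suc N) (suc (suc k)) ≈ E ⊛ b ⊕ c
        shifted = subst (λ z → qbin q (suc z) (suc (suc k)) ≈ E ⊛ qbin q z (suc k) ⊕ qbin q z (suc (suc k)))
                        (sym (+-suc k e)) (qbin-dual-pascal (suc k) e)

      -- b records a descent at the front: without it this is the q-Pascal rule defining qbin, with it the dual rule
      pascal-by-descent : ∀ b K m P →
        pow q (if b then suc (K + suc m) else 0) ⊛ (P ⊛ qbin q (K + suc m) K) ⊕ 1# ⊛ (P ⊛ (pow q (suc K) ⊛ qbin q (suc K + m) (suc K)))
        ≈ pow q (if b then suc K else 0) ⊛ P ⊛ qbin q (suc K + suc m) (suc K)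
      pascal-by-descent b K m P =
        ≈-trans (R.+-congˡ (R.*-congˡ (R.*-congˡ (R.*-congˡ (≈-reflexive (cong (λ n → qbin q n (suc K)) (sym (+-suc K m))))))))
                (split b)
        where
        X = pow q (suc K)
        Q₁ = qbin q (K + suc m) K
        Q₂ = qbin q (K + suc m) (suc K)
        split : ∀ b → pow q (if b then suc (K + suc m) else 0) ⊛ (P ⊛ Q₁) ⊕ 1# ⊛ (P ⊛ (X ⊛ Q₂))
                      ≈ pow q (if b then suc K else 0) ⊛ P ⊛ qbin q (suc K + suc m) (suc K)
        split false = solve 4 (λ P A X B → (con 1 :* (P :* A) :+ con 1 :* (P :* (X :* B))) := (con 1 :* P :* (A :+ X :* B)))
                        ≈-refl P Q₁ X Q₂
        split true = begin
            pow q (suc K + suc m) ⊛ (P ⊛ Q₁) ⊕ 1# ⊛ (P ⊛ (X ⊛ Q₂))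
          ≈⟨ R.+-congʳ (R.*-congʳ (pow-+ q (suc K) (suc m))) ⟩
            X ⊛ pow q (suc m) ⊛ (P ⊛ Q₁) ⊕ 1# ⊛ (P ⊛ (X ⊛ Q₂))
          ≈⟨ solve 5 (λ X Y P A B → ((X :* Y) :* (P :* A) :+ con 1 :* (P :* (X :* B))) := ((X :* P) :* (Y :* A :+ B)))
               ≈-refl X (pow q (suc m)) P Q₁ Q₂ ⟩
            X ⊛ P ⊛ (pow q (suc m) ⊛ Q₁ ⊕ Q₂)
          ≈⟨ R.*-congˡ (≈-sym (qbin-dual-pascal K (suc m))) ⟩
            X ⊛ P ⊛ qbin q (suc K + suc m) (suc K) ∎

      -- Generating functions over shuffles

      invs-∷-shuffleSum : ∀ x u lo m →
        sumR (map (pow q ∘ invs ∘ (x ∷_)) (shuffles u (interval lo m)))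
        ≈ pow q (countLess x u + countLess x (interval lo m)) ⊛ sumR (map (pow q ∘ invs) (shuffles u (interval lo m)))
      invs-∷-shuffleSum x u lo m =
        sumR-pow-shift (invs ∘ (x ∷_)) invs _ (shuffles u (interval lo m))
          (λ {w} w∈ → cong (_+ invs w) (countLess-shuffle x u (interval lo m) w∈))

      invs-shuffleSum : ∀ lo u m → All (_< lo) u →
        sumR (map (pow q ∘ invs) (shuffles u (interval lo m))) ≈ pow q (invs u) ⊛ qbin q (length u + m) (length u)
      invs-lowPrefixSum : ∀ lo x xs m → x < lo → All (_< lo) xs →
        sumR (map (pow q ∘ invs ∘ (x ∷_)) (shuffles xs (interval lo m)))
        ≈ pow q (invs (x ∷ xs)) ⊛ qbin q (length xs + m) (length xs)
      invs-highPrefixSum : ∀ lo u m → All (_< lo) u →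
        sumR (map (pow q ∘ invs ∘ (lo ∷_)) (shuffles u (interval (suc lo) m)))
        ≈ pow q (invs u) ⊛ (pow q (length u) ⊛ qbin q (length u + m) (length u))

      invs-shuffleSum lo [] m _ rewrite shuffles-[]ˡ (interval lo m) | invs-interval lo m =
        ≈-trans (R.+-identityʳ _) (≈-sym (R.*-identityˡ _))
      invs-shuffleSum lo (x ∷ xs) zero _ rewrite shuffles-[]ʳ (x ∷ xs) | +-identityʳ (length xs) =
        ≈-trans (R.+-identityʳ _) (≈-sym (≈-trans (R.*-congˡ (qbin-diagonal (suc (length xs)))) (R.*-identityʳ _)))
      invs-shuffleSum lo (x ∷ xs) (suc m) (x<lo ∷ xs<lo) = begin
          sumR (map (pow q ∘ invs) (shuffles (x ∷ xs) (lo ∷ interval (suc lo) m)))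
        ≈⟨ shuffleSum-∷-∷ (pow q ∘ invs) x xs lo (interval (suc lo) m) ⟩
          sumR (map (pow q ∘ invs ∘ (x ∷_)) (shuffles xs (interval lo (suc m))))
            ⊕ sumR (map (pow q ∘ invs ∘ (lo ∷_)) (shuffles (x ∷ xs) (interval (suc lo) m)))
        ≈⟨ R.+-cong (invs-lowPrefixSum lo x xs (suc m) x<lo xs<lo) (invs-highPrefixSum lo (x ∷ xs) m (x<lo ∷ xs<lo)) ⟩
          I ⊛ qbin q (K + suc m) K ⊕ I ⊛ (pow q (suc K) ⊛ qbin q (suc K + m) (suc K))
        ≡⟨ cong (λ n → I ⊛ qbin q (K + suc m) K ⊕ I ⊛ (pow q (suc K) ⊛ qbin q n (suc K))) (sym (+-suc K m)) ⟩
          I ⊛ qbin q (K + suc m) K ⊕ I ⊛ (pow q (suc K) ⊛ qbin q (K + suc m) (suc K))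
        ≈⟨ ≈-sym (R.distribˡ I _ _) ⟩
          I ⊛ qbin q (suc K + suc m) (suc K) ∎
        where
        K = length xs
        I = pow q (invs (x ∷ xs))

      invs-lowPrefixSum lo x xs m x<lo xs<lo = begin
          sumR (map (pow q ∘ invs ∘ (x ∷_)) (shuffles xs (interval lo m)))
        ≈⟨ invs-∷-shuffleSum x xs lo m ⟩
          pow q (countLess x xs + countLess x (interval lo m)) ⊛ S
        ≡⟨ cong (λ k → pow q (countLess x xs + k) ⊛ S) (countLess-interval x lo m (<⇒≤ x<lo)) ⟩
          pow q (countLess x xs + 0) ⊛ S
        ≈⟨ R.*-cong (≈-reflexive (cong (pow q) (+-identityʳ (countLess x xs)))) (invs-shuffleSum lo xs m xs<lo) ⟩
          pow q (countLess x xs) ⊛ (pow q (invs xs) ⊛ qbin q (length xs + m) (length xs))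
        ≈⟨ ≈-trans (≈-sym (R.*-assoc _ _ _)) (R.*-congʳ (≈-sym (pow-+ q (countLess x xs) (invs xs)))) ⟩
          pow q (invs (x ∷ xs)) ⊛ qbin q (length xs + m) (length xs) ∎
        where S = sumR (map (pow q ∘ invs) (shuffles xs (interval lo m)))

      invs-highPrefixSum lo u m u<lo = begin
          sumR (map (pow q ∘ invs ∘ (lo ∷_)) (shuffles u (interval (suc lo) m)))
        ≈⟨ invs-∷-shuffleSum lo u (suc lo) m ⟩
          pow q (countLess lo u + countLess lo (interval (suc lo) m)) ⊛ S
        ≡⟨ cong₂ (λ k l → pow q (k + l) ⊛ S) (countLess-all< lo u u<lo) (countLess-interval lo (suc lo) m (n≤1+n lo)) ⟩
          pow q (length u + 0) ⊛ S
        ≈⟨ R.*-cong (≈-reflexive (cong (pow q) (+-identityʳ (length u)))) (invs-shuffleSum (suc lo) u m (All.map m<n⇒m<1+n u<lo)) ⟩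
          pow q (length u) ⊛ (pow q (invs u) ⊛ qbin q (length u + m) (length u))
        ≈⟨ solve 3 (λ X I B → X :* (I :* B) := I :* (X :* B)) ≈-refl (pow q (length u)) (pow q (invs u)) (qbin q (length u + m) (length u)) ⟩
          pow q (invs u) ⊛ (pow q (length u) ⊛ qbin q (length u + m) (length u)) ∎
        where S = sumR (map (pow q ∘ invs) (shuffles u (interval (suc lo) m)))

      rmaj-∷-∷-sum : ∀ x y (L : List (List ℕ)) N → (∀ {w} → w ∈ L → length w ≡ N) →
        sumR (map (λ w → pow q (rmaj (x ∷ y ∷ w))) L)
        ≈ pow q (if y <ᵇ x then suc N else 0) ⊛ sumR (map (pow q ∘ rmaj ∘ (y ∷_)) L)
      rmaj-∷-∷-sum x y L N len =
        sumR-pow-shift (λ w → rmaj (x ∷ y ∷ w)) (rmaj ∘ (y ∷_)) _ L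
          (λ {w} w∈ → trans (rmaj-∷ x (y ∷ w)) (cong (λ l → (if y <ᵇ x then suc l else 0) + rmaj (y ∷ w)) (len w∈)))

      rmaj-lowPrefixSum : ∀ lo x xs m → x < lo → All (_< lo) xs →
        sumR (map (pow q ∘ rmaj ∘ (x ∷_)) (shuffles xs (interval lo m)))
        ≈ pow q (rmaj (x ∷ xs)) ⊛ qbin q (length xs + m) (length xs)
      rmaj-highPrefixSum : ∀ lo x xs m → x < lo → All (_< lo) xs →
        sumR (map (pow q ∘ rmaj ∘ (lo ∷_)) (shuffles (x ∷ xs) (interval (suc lo) m)))
        ≈ pow q (rmaj (x ∷ xs)) ⊛ (pow q (suc (length xs)) ⊛ qbin q (suc (length xs) + m) (suc (length xs)))

      rmaj-lowPrefixSum lo x [] m x<lo _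
        rewrite shuffles-[]ˡ (interval lo m) | rmaj-∷ x (interval lo m) | rmajHead-interval x lo m (<⇒≤ x<lo) | rmaj-interval lo m =
        ≈-trans (R.+-identityʳ _) (≈-sym (R.*-identityˡ _))
      rmaj-lowPrefixSum lo x (x₂ ∷ xs) zero x<lo _ rewrite shuffles-[]ʳ (x₂ ∷ xs) | +-identityʳ (length xs) =
        ≈-trans (R.+-identityʳ _) (≈-sym (≈-trans (R.*-congˡ (qbin-diagonal (suc (length xs)))) (R.*-identityʳ _)))
      rmaj-lowPrefixSum lo x (x₂ ∷ xs) (suc m) x<lo (x₂<lo ∷ xs<lo) = begin
          sumR (map (pow q ∘ rmaj ∘ (x ∷_)) (shuffles (x₂ ∷ xs) (lo ∷ ys)))
        ≈⟨ shuffleSum-∷-∷ (pow q ∘ rmaj ∘ (x ∷_)) x₂ xs lo ys ⟩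
          sumR (map (λ w → pow q (rmaj (x ∷ x₂ ∷ w))) L₁) ⊕ sumR (map (λ w → pow q (rmaj (x ∷ lo ∷ w))) L₂)
        ≈⟨ R.+-cong (rmaj-∷-∷-sum x x₂ L₁ (K + suc m) (∈-shuffles⇒length xs lo (suc m)))
                    (rmaj-∷-∷-sum x lo L₂ (suc K + m) (∈-shuffles⇒length (x₂ ∷ xs) (suc lo) m)) ⟩
          pow q (if x₂ <ᵇ x then suc (K + suc m) else 0) ⊛ Σ₁ ⊕ pow q (if lo <ᵇ x then suc (suc K + m) else 0) ⊛ Σ₂
        ≡⟨ cong (λ b → pow q (if x₂ <ᵇ x then suc (K + suc m) else 0) ⊛ Σ₁ ⊕ pow q (if b then suc (suc K + m) else 0) ⊛ Σ₂)
                (≥⇒<ᵇ≡false (<⇒≤ x<lo)) ⟩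
          pow q (if x₂ <ᵇ x then suc (K + suc m) else 0) ⊛ Σ₁ ⊕ 1# ⊛ Σ₂
        ≈⟨ R.+-cong (R.*-congˡ (rmaj-lowPrefixSum lo x₂ xs (suc m) x₂<lo xs<lo))
                    (R.*-congˡ (rmaj-highPrefixSum lo x₂ xs m x₂<lo xs<lo)) ⟩
          pow q (if x₂ <ᵇ x then suc (K + suc m) else 0) ⊛ (P ⊛ qbin q (K + suc m) K)
            ⊕ 1# ⊛ (P ⊛ (pow q (suc K) ⊛ qbin q (suc K + m) (suc K)))
        ≈⟨ pascal-by-descent (x₂ <ᵇ x) K m P ⟩
          pow q (rmajHead x (x₂ ∷ xs)) ⊛ P ⊛ qbin q (suc K + suc m) (suc K)
        ≈⟨ R.*-congʳ (≈-trans (≈-sym (pow-+ q (rmajHead x (x₂ ∷ xs)) (rmaj (x₂ ∷ xs))))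
                              (≈-reflexive (cong (pow q) (sym (rmaj-∷ x (x₂ ∷ xs)))))) ⟩
          pow q (rmaj (x ∷ x₂ ∷ xs)) ⊛ qbin q (suc K + suc m) (suc K) ∎
        where
        K = length xs
        P = pow q (rmaj (x₂ ∷ xs))
        ys = interval (suc lo) m
        L₁ = shuffles xs (lo ∷ ys)
        L₂ = shuffles (x₂ ∷ xs) ys
        Σ₁ = sumR (map (pow q ∘ rmaj ∘ (x₂ ∷_)) L₁)
        Σ₂ = sumR (map (pow q ∘ rmaj ∘ (lo ∷_)) L₂)

      rmaj-highPrefixSum lo x xs zero x<lo _
        rewrite shuffles-[]ʳ (x ∷ xs) | rmaj-∷ lo (x ∷ xs) | <⇒<ᵇ≡true x<lo | +-identityʳ (length xs) = begin
          pow q (suc (length xs) + rmaj (x ∷ xs)) ⊕ 0#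
        ≈⟨ R.+-identityʳ _ ⟩
          pow q (suc (length xs) + rmaj (x ∷ xs))
        ≈⟨ ≈-trans (pow-+ q (suc (length xs)) (rmaj (x ∷ xs))) (R.*-comm _ _) ⟩
          pow q (rmaj (x ∷ xs)) ⊛ pow q (suc (length xs))
        ≈⟨ R.*-congˡ (≈-sym (≈-trans (R.*-congˡ (qbin-diagonal (suc (length xs)))) (R.*-identityʳ _))) ⟩
          pow q (rmaj (x ∷ xs)) ⊛ (pow q (suc (length xs)) ⊛ qbin q (suc (length xs)) (suc (length xs))) ∎
      rmaj-highPrefixSum lo x xs (suc m) x<lo xs<lo = begin
          sumR (map (pow q ∘ rmaj ∘ (lo ∷_)) (shuffles (x ∷ xs) (suc lo ∷ ys)))
        ≈⟨ shuffleSum-∷-∷ (pow q ∘ rmaj ∘ (lo ∷_)) x xs (suc lo) ys ⟩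
          sumR (map (λ w → pow q (rmaj (lo ∷ x ∷ w))) L₁) ⊕ sumR (map (λ w → pow q (rmaj (lo ∷ suc lo ∷ w))) L₂)
        ≈⟨ R.+-cong (rmaj-∷-∷-sum lo x L₁ (K + suc m) (∈-shuffles⇒length xs (suc lo) (suc m)))
                    (rmaj-∷-∷-sum lo (suc lo) L₂ (suc K + m) (∈-shuffles⇒length (x ∷ xs) (suc (suc lo)) m)) ⟩
          pow q (if x <ᵇ lo then suc (K + suc m) else 0) ⊛ Σ₁ ⊕ pow q (if suc lo <ᵇ lo then suc (suc K + m) else 0) ⊛ Σ₂
        ≡⟨ cong₂ (λ b b′ → pow q (if b then suc (K + suc m) else 0) ⊛ Σ₁ ⊕ pow q (if b′ then suc (suc K + m) else 0) ⊛ Σ₂)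
                 (<⇒<ᵇ≡true x<lo) (≥⇒<ᵇ≡false (n≤1+n lo)) ⟩
          pow q (suc (K + suc m)) ⊛ Σ₁ ⊕ 1# ⊛ Σ₂
        ≈⟨ R.+-cong (R.*-congˡ (rmaj-lowPrefixSum (suc lo) x xs (suc m) x<1+lo xs<1+lo))
                    (R.*-congˡ (rmaj-highPrefixSum (suc lo) x xs m x<1+lo xs<1+lo)) ⟩
          pow q (suc (K + suc m)) ⊛ (P ⊛ qbin q (K + suc m) K) ⊕ 1# ⊛ (P ⊛ (pow q (suc K) ⊛ qbin q (suc K + m) (suc K)))
        ≈⟨ pascal-by-descent true K m P ⟩
          pow q (suc K) ⊛ P ⊛ qbin q (suc K + suc m) (suc K)
        ≈⟨ solve 3 (λ X P B → (X :* P) :* B := P :* (X :* B)) ≈-refl (pow q (suc K)) P (qbin q (suc K + suc m) (suc K)) ⟩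
          P ⊛ (pow q (suc K) ⊛ qbin q (suc K + suc m) (suc K)) ∎
        where
        K = length xs
        P = pow q (rmaj (x ∷ xs))
        ys = interval (suc (suc lo)) m
        L₁ = shuffles xs (suc lo ∷ ys)
        L₂ = shuffles (x ∷ xs) ys
        Σ₁ = sumR (map (pow q ∘ rmaj ∘ (x ∷_)) L₁)
        Σ₂ = sumR (map (pow q ∘ rmaj ∘ (suc lo ∷_)) L₂)
        x<1+lo : x < suc lo
        x<1+lo = m<n⇒m<1+n x<lo
        xs<1+lo : All (_< suc lo) xs
        xs<1+lo = All.map m<n⇒m<1+n xs<lo

      weightedShuffleSum : ∀ (S : List ℕ → ℕ) lo x xs z → x < lo →
        (∀ m → sumR (map (pow q ∘ S ∘ (x ∷_)) (shuffles xs (interval lo m)))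
               ≈ pow q (S (x ∷ xs)) ⊛ qbin q (length xs + m) (length xs)) →
        (∀ m → sumR (map (pow q ∘ S ∘ (lo ∷_)) (shuffles (x ∷ xs) (interval (suc lo) m)))
               ≈ pow q (S (x ∷ xs)) ⊛ (pow q (suc (length xs)) ⊛ qbin q (suc (length xs) + m) (suc (length xs)))) →
        ∀ m → sumR (map (λ w → pow q (S w) ⊛ weight lo z w) (shuffles (x ∷ xs) (interval lo m)))
              ≈ pow q (S (x ∷ xs)) ⊛ (qbin q (length xs + m) (length xs) ⊕ z ⊛ pow q (suc (length xs)) ⊛ qbin q (length xs + m) (suc (length xs)))
      weightedShuffleSum S lo x xs z x<lo _ _ zero
        rewrite shuffles-[]ʳ (x ∷ xs) | ≢⇒≡ᵇ≡false (<⇒≢ x<lo) | +-identityʳ (length xs) = begin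
          pow q (S (x ∷ xs)) ⊛ 1# ⊕ 0#
        ≈⟨ R.+-identityʳ _ ⟩
          pow q (S (x ∷ xs)) ⊛ 1#
        ≈⟨ R.*-congˡ (≈-sym unit) ⟩
          pow q (S (x ∷ xs)) ⊛ (qbin q K K ⊕ z ⊛ pow q (suc K) ⊛ qbin q K (suc K)) ∎
        where
        K = length xs
        unit : qbin q K K ⊕ z ⊛ pow q (suc K) ⊛ qbin q K (suc K) ≈ 1#
        unit = ≈-trans (R.+-cong (qbin-diagonal K) (≈-trans (R.*-congˡ (qbin-vanish K (suc K) ≤-refl)) (R.zeroʳ _)))
                       (R.+-identityʳ 1#)
      weightedShuffleSum S lo x xs z x<lo lowPrefix highPrefix (suc m) = begin
          sumR (map F (shuffles (x ∷ xs) (lo ∷ ys)))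
        ≈⟨ shuffleSum-∷-∷ F x xs lo ys ⟩
          sumR (map (F ∘ (x ∷_)) L₁) ⊕ sumR (map (F ∘ (lo ∷_)) L₂)
        ≈⟨ R.+-cong (sumR-map-cong (F ∘ (x ∷_)) (pow q ∘ S ∘ (x ∷_)) L₁
                      (λ _ → ≈-trans (R.*-congˡ (≈-reflexive (cong (λ b → if b then z else 1#) (≢⇒≡ᵇ≡false (<⇒≢ x<lo))))) (R.*-identityʳ _)))
                    (≈-trans (sumR-map-cong (F ∘ (lo ∷_)) (λ w → z ⊛ pow q (S (lo ∷ w))) L₂
                               (λ _ → ≈-trans (R.*-congˡ (≈-reflexive (cong (λ b → if b then z else 1#) (≡ᵇ-refl lo)))) (R.*-comm _ _)))
                             (sumR-map-*ˡ z (pow q ∘ S ∘ (lo ∷_)) L₂)) ⟩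
          sumR (map (pow q ∘ S ∘ (x ∷_)) L₁) ⊕ z ⊛ sumR (map (pow q ∘ S ∘ (lo ∷_)) L₂)
        ≈⟨ R.+-cong (lowPrefix (suc m)) (R.*-congˡ (highPrefix m)) ⟩
          P ⊛ qbin q (K + suc m) K ⊕ z ⊛ (P ⊛ (X ⊛ qbin q (suc K + m) (suc K)))
        ≡⟨ cong (λ n → P ⊛ qbin q (K + suc m) K ⊕ z ⊛ (P ⊛ (X ⊛ qbin q n (suc K)))) (sym (+-suc K m)) ⟩
          P ⊛ qbin q (K + suc m) K ⊕ z ⊛ (P ⊛ (X ⊛ qbin q (K + suc m) (suc K)))
        ≈⟨ solve 5 (λ P A z X B → (P :* A :+ z :* (P :* (X :* B))) := (P :* (A :+ z :* X :* B)))
             ≈-refl P (qbin q (K + suc m) K) z X (qbin q (K + suc m) (suc K)) ⟩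
          P ⊛ (qbin q (K + suc m) K ⊕ z ⊛ X ⊛ qbin q (K + suc m) (suc K)) ∎
        where
        K = length xs
        P = pow q (S (x ∷ xs))
        X = pow q (suc K)
        ys = interval (suc lo) m
        L₁ = shuffles xs (lo ∷ ys)
        L₂ = shuffles (x ∷ xs) ys
        F = λ w → pow q (S w) ⊛ weight lo z w

    module _ (t : ℕ → Carrier) where

      flagWeight : List Bool → ℕ → Carrier
      flagWeight [] d = 1#
      flagWeight (b ∷ bs) d = (if b then t d else 1#) ⊛ flagWeight bs (suc d)

      flagWeight-++ : ∀ A B d → flagWeight (A ++ B) d ≈ flagWeight A d ⊛ flagWeight B (d + length A)
      flagWeight-++ [] B d = ≈-trans (≈-reflexive (cong (flagWeight B) (sym (+-identityʳ d)))) (≈-sym (R.*-identityˡ _))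
      flagWeight-++ (b ∷ A) B d = begin
          (if b then t d else 1#) ⊛ flagWeight (A ++ B) (suc d)
        ≈⟨ R.*-congˡ (flagWeight-++ A B (suc d)) ⟩
          (if b then t d else 1#) ⊛ (flagWeight A (suc d) ⊛ flagWeight B (suc d + length A))
        ≈⟨ ≈-sym (R.*-assoc _ _ _) ⟩
          (if b then t d else 1#) ⊛ flagWeight A (suc d) ⊛ flagWeight B (suc d + length A)
        ≡⟨ cong (λ k → (if b then t d else 1#) ⊛ flagWeight A (suc d) ⊛ flagWeight B k) (sym (+-suc d (length A))) ⟩
          (if b then t d else 1#) ⊛ flagWeight A (suc d) ⊛ flagWeight B (d + suc (length A)) ∎

      flagWeight-insertionFlags : ∀ m b d → (m ≡ 0 → b ≡ false) → flagWeight (insertionFlags m b) d ≈ (if b then t d else 1#)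
      flagWeight-insertionFlags zero b d b≡false rewrite b≡false refl = ≈-refl
      flagWeight-insertionFlags (suc m) b d _ = ≈-trans (R.*-congˡ (allFalse m (suc d))) (R.*-identityʳ _)
        where
        allFalse : ∀ m d → flagWeight (replicate m false) d ≈ 1#
        allFalse zero d = ≈-refl
        allFalse (suc m) d = ≈-trans (R.*-identityˡ _) (allFalse m (suc d))

      private
        drop-∷ : ∀ d (K : List ℕ) → d < length K → drop d K ≡ nth d K ∷ drop (suc d) K
        drop-∷ zero (k ∷ K) _ = refl
        drop-∷ (suc d) (k ∷ K) (s≤s d<) = drop-∷ d K d<

        drop-length : ∀ d (K : List ℕ) → length K ≡ d → drop d K ≡ []
        drop-length zero [] _ = refl
        drop-length (suc d) (k ∷ K) len = drop-length d K (suc-injective len)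

        tbarFold : ∀ (K : List ℕ) d L → length K ≡ d + L →
          foldr (λ j acc → (if nth (j ∸ 1) K ≡ᵇ j then t j else 1#) ⊛ acc) 1# (interval (suc d) L)
          ≡ flagWeight (fullCycleFlags (drop d K) (suc d)) (suc d)
        tbarFold K d zero len rewrite drop-length d K (trans len (+-identityʳ d)) = refl
        tbarFold K d (suc L) len rewrite drop-∷ d K (subst (d <_) (sym len) (m<m+n d (s≤s z≤n))) =
          cong ((if nth d K ≡ᵇ suc d then t (suc d) else 1#) ⊛_) (tbarFold K (suc d) L (trans len (+-suc d L)))

      tbar≡flagWeight : ∀ w → length (factorTuple w) ≡ length w ∸ 1 → tbar t w ≡ flagWeight (fullCycleFlags (factorTuple w) 1) 1
      tbar≡flagWeight w len =
        trans (cong (foldr (λ j acc → (if ε j w then t j else 1#) ⊛ acc) 1#) (range≡interval (length w ∸ 1)))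
              (tbarFold (factorTuple w) 0 (length w ∸ 1) len)

      tbar-shuffle : ∀ i₀ u ku → ku ∈ tuples i₀ → tupleWord (suc i₀) ku ≡ u → startsWith (suc (suc i₀)) u ≡ false →
        ∀ m {w} → w ∈ shuffles u (interval (suc (suc i₀)) m) →
        tbar t w ≈ flagWeight (fullCycleFlags ku 1) 1 ⊛ weight (suc (suc i₀)) (t (suc i₀)) w
      tbar-shuffle i₀ u ku ku∈ ku↦u u-head m {w} w∈ with shuffle-factorisation i₀ u ku ku∈ ku↦u u-head m w∈
      ... | ks , ks∈ , ks↦w , flags = begin
          tbar t w
        ≡⟨ tbar≡flagWeight w (trans (cong length factor≡) (trans (∈-tuples⇒length (m + i₀) ks∈) (cong (_∸ 1) (sym len-w)))) ⟩
          flagWeight (fullCycleFlags (factorTuple w) 1) 1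
        ≡⟨ cong (λ K → flagWeight (fullCycleFlags K 1) 1) factor≡ ⟩
          flagWeight (fullCycleFlags ks 1) 1
        ≡⟨ cong (λ F → flagWeight F 1) flags ⟩
          flagWeight (fullCycleFlags ku 1 ++ insertionFlags m h) 1
        ≈⟨ flagWeight-++ (fullCycleFlags ku 1) (insertionFlags m h) 1 ⟩
          flagWeight (fullCycleFlags ku 1) 1 ⊛ flagWeight (insertionFlags m h) (suc (length (fullCycleFlags ku 1)))
        ≡⟨ cong (λ k → flagWeight (fullCycleFlags ku 1) 1 ⊛ flagWeight (insertionFlags m h) (suc k))
                (trans (length-fullCycleFlags ku 1) (∈-tuples⇒length i₀ ku∈)) ⟩
          flagWeight (fullCycleFlags ku 1) 1 ⊛ flagWeight (insertionFlags m h) (suc i₀)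
        ≈⟨ R.*-congˡ (flagWeight-insertionFlags m h (suc i₀) onlyU) ⟩
          flagWeight (fullCycleFlags ku 1) 1 ⊛ weight (suc (suc i₀)) (t (suc i₀)) w ∎
        where
        h = startsWith (suc (suc i₀)) w
        factor≡ : factorTuple w ≡ ks
        factor≡ = factorTuple-tupleWord (m + i₀) ks w ks∈ ks↦w
        len-w : length w ≡ suc (m + i₀)
        len-w = trans (cong length (sym ks↦w)) (length-tupleWord _ ks)
        onlyU : m ≡ 0 → h ≡ false
        onlyU refl = trans (cong (startsWith (suc (suc i₀))) (∈-shuffles-[]ʳ u w∈)) u-head

    grassmannianSum≈shuffleSum : ∀ (F : List ℕ → Carrier) i₀ m u → length u ≡ suc i₀ →
      sumR (map (F ∘ ((u ++ interval (suc (suc i₀)) m) ∙ₚ_)) (inverseGrassmannian (suc i₀) (suc i₀ + m)))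
      ≈ sumR (map F (shuffles u (interval (suc (suc i₀)) m)))
    grassmannianSum≈shuffleSum F i₀ m u len =
      ≈-trans (sumR-map-↭ (F ∘ (σ ∙ₚ_)) (inverseGrassmannian↭shuffles i₀ m))
              (≈-reflexive (cong sumR (trans (map-∘ (shuffles low high)) (cong (map F) relabelled))))
      where
      low = interval 1 (suc i₀)
      high = interval (suc (suc i₀)) m
      σ = u ++ high
      relabelled : map (σ ∙ₚ_) (shuffles low high) ≡ shuffles u high
      relabelled = trans (map-shuffles (app σ) low high) (cong₂ shuffles
        (subst (λ k → map (app σ) (interval 1 k) ≡ u) len (map-app-++-prefix u high))
        (subst (λ k → map (app (u ++ interval (suc k) m)) (interval (suc k) m) ≡ interval (suc k) m) len (map-app-++-interval u m)))

    module _ (q : Carrier) (t : ℕ → Carrier) where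

      statisticSum : ∀ (S : List ℕ → ℕ) Sσ x xs m → x ∷ xs ↭ interval 1 (suc (length xs)) → S (x ∷ xs) ≡ Sσ →
        (∀ m → sumR (map (pow q ∘ S ∘ (x ∷_)) (shuffles xs (interval (suc (suc (length xs))) m)))
               ≈ pow q (S (x ∷ xs)) ⊛ qbin q (length xs + m) (length xs)) →
        (∀ m → sumR (map (pow q ∘ S ∘ (suc (suc (length xs)) ∷_)) (shuffles (x ∷ xs) (interval (suc (suc (suc (length xs)))) m)))
               ≈ pow q (S (x ∷ xs)) ⊛ (pow q (suc (length xs)) ⊛ qbin q (suc (length xs) + m) (suc (length xs)))) →
        let K = length xs
            σ = (x ∷ xs) ++ interval (suc (suc K)) m
        in sumR (map (λ r → pow q (S (σ ∙ₚ r)) ⊛ tbar t (σ ∙ₚ r)) (inverseGrassmannian (suc K) (suc K + m)))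
           ≈ pow q Sσ ⊛ tbar t σ ⊛ (qbin q (K + m) K ⊕ t (suc K) ⊛ pow q (suc K) ⊛ qbin q (K + m) (suc K))
      statisticSum S Sσ x xs m u↭ S≡ lowPrefix highPrefix = begin
          sumR (map (F ∘ (σ ∙ₚ_)) (inverseGrassmannian (suc K) (suc K + m)))
        ≈⟨ grassmannianSum≈shuffleSum F K m u (trans (↭-length u↭) (length-interval 1 (suc K))) ⟩
          sumR (map F (shuffles u high))
        ≈⟨ sumR-map-cong F (λ w → C ⊛ (pow q (S w) ⊛ weight lo z w)) (shuffles u high)
             (λ {w} w∈ → ≈-trans (R.*-congˡ (tbar-shuffle t K u ku ku∈ ku↦u u-head m w∈))
                                 (solve 3 (λ P C G → P :* (C :* G) := C :* (P :* G)) ≈-refl (pow q (S w)) C (weight lo z w))) ⟩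
          sumR (map (λ w → C ⊛ (pow q (S w) ⊛ weight lo z w)) (shuffles u high))
        ≈⟨ sumR-map-*ˡ C (λ w → pow q (S w) ⊛ weight lo z w) (shuffles u high) ⟩
          C ⊛ sumR (map (λ w → pow q (S w) ⊛ weight lo z w) (shuffles u high))
        ≈⟨ R.*-congˡ (weightedShuffleSum q S lo x xs z x<lo lowPrefix highPrefix m) ⟩
          C ⊛ (pow q (S u) ⊛ rhs)
        ≈⟨ solve 3 (λ C P B → C :* (P :* B) := P :* C :* B) ≈-refl C (pow q (S u)) rhs ⟩
          pow q (S u) ⊛ C ⊛ rhs
        ≈⟨ R.*-congʳ (R.*-cong (≈-reflexive (cong (pow q) S≡)) C≈tbarσ) ⟩
          pow q Sσ ⊛ tbar t σ ⊛ rhs ∎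
        where
        K = length xs
        u = x ∷ xs
        lo = suc (suc K)
        z = t (suc K)
        high = interval lo m
        σ = u ++ high
        rhs = qbin q (K + m) K ⊕ z ⊛ pow q (suc K) ⊛ qbin q (K + m) (suc K)
        F = λ w → pow q (S w) ⊛ tbar t w
        x<lo : x < lo
        x<lo = proj₂ (∈-interval⁻ 1 (suc K) (∈-resp-↭ u↭ (here refl)))
        u-head : startsWith lo u ≡ false
        u-head = ≢⇒≡ᵇ≡false (<⇒≢ x<lo)
        factorisation : Σ (List ℕ) λ ks → ks ∈ tuples K × tupleWord (suc K) ks ≡ u
        factorisation = tupleWord-surjective K u u↭
        ku : List ℕ
        ku = proj₁ factorisation
        ku∈ : ku ∈ tuples K
        ku∈ = proj₁ (proj₂ factorisation)
        ku↦u : tupleWord (suc K) ku ≡ u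
        ku↦u = proj₂ (proj₂ factorisation)
        C = flagWeight t (fullCycleFlags ku 1) 1
        C≈tbarσ : C ≈ tbar t σ
        C≈tbarσ = ≈-sym (≈-trans (tbar-shuffle t K u ku ku∈ ku↦u u-head m (++∈shuffles u high))
                                 (≈-trans (R.*-congˡ (≈-reflexive (cong (λ b → if b then z else 1#) u-head))) (R.*-identityʳ C)))

lemma9p3 : ∀ {c ℓ} (R : CommutativeRing c ℓ) → let open CommutativeRing R in let open RingDefs R in
    (n i : ℕ) → 1 ≤ i → i ≤ n →
    (σ : List ℕ) → σ ↭ range n →
    (∀ k → 1 ≤ k → k ≤ n → app σ k ≢ k → k ≤ i) →
    (q : Carrier) (t : ℕ → Carrier) →
    let rhs = qbin q (n ∸ 1) (i ∸ 1) + t i * pow q i * qbin q (n ∸ 1) i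
        R₀ = filterᵇ (λ r → desSubsetSingleton i (inverse r)) (Sym n)
    in (sumR (map (λ r → pow q (invs (σ ∙ₚ r)) * tbar t (σ ∙ₚ r)) R₀)
          ≈ pow q (invs σ) * tbar t σ * rhs)
       × (sumR (map (λ r → pow q (rmaj (σ ∙ₚ r)) * tbar t (σ ∙ₚ r)) R₀)
          ≈ pow q (rmaj (take i σ)) * tbar t σ * rhs)
lemma9p3 R n i 1≤i i≤n σ σ↭ supp q t with decompose-supportedIn n i 1≤i i≤n σ σ↭ supp
... | x , xs , m , refl , refl , refl , u↭ =
  statisticSum R q t invs (invs ((x ∷ xs) ++ high)) x xs m u↭ (sym (invs-++-interval lo (x ∷ xs) m u<lo))
    (λ m → invs-lowPrefixSum R q lo x xs m x<lo xs<lo) (λ m → invs-highPrefixSum R q lo (x ∷ xs) m u<lo) ,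
  statisticSum R q t rmaj (rmaj (take (suc (length xs)) ((x ∷ xs) ++ high))) x xs m u↭ (cong rmaj (sym (take-length-++ (x ∷ xs) high)))
    (λ m → rmaj-lowPrefixSum R q lo x xs m x<lo xs<lo) (λ m → rmaj-highPrefixSum R q lo x xs m x<lo xs<lo)
  where
  lo = suc (suc (length xs))
  high = interval lo m
  u<lo : All (_< lo) (x ∷ xs)
  u<lo = ↭-interval⇒All< (suc (length xs)) u↭
  x<lo : x < lo
  x<lo = All.head u<lo
  xs<lo : All (_< lo) xs
  xs<lo = All.tail u<lo
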